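{- As formal power series in $z,t$ (with Laurent factors in $t$ on the right), $$\sum_{Q\in\operatorname{IPPM}} z^{v(Q)}t^{w(Q)} \;=\; \sum_{P\in\operatorname{PM}} z^{w(P)}\,t^{2w(P)}\,(1+t^{ -1})^{\dim(P)}.$$
   Context: For $n\ge1$ let $[n]=\{1,\ldots,n\}$. A partition matrix on $[n]$ is an upper-triangular square matrix whose entries are subsets of $[n]$ (entries below the diagonal are empty) such that: each row and each column contains at least one nonempty entry; the nonempty entries form a set partition of $[n]$; and for all $i,j\in[n]$, if $\operatorname{col}(i)<\operatorname{col}(j)$ then $i<j$, where $\operatorname{col}(k)$ (resp. $\operatorname{row}(k)$) is the column (resp. row) index of the entry containing $k$. Its weight $w(P)$ is $n$ and its dimension $\dim(P)$ is its number of rows. $\operatorname{PM}$ is the set of all partition matrices (of all weights $n\ge1$). For $1<i<n$, $i$ is a descent (resp. ascent) of $P$ if $\operatorname{col}(i)=\operatorname{col}(i+1)$ and $\operatorname{row}(i)>\operatorname{row}(i+1)$ (resp. $\operatorname{row}(i)<\operatorname{row}(i+1)$). A descent or ascent $i$ is proper if $i\equiv j\pmod 2$, where $j$ is the minimal element in column $\operatorname{col}(i)$, and improper otherwise. $\operatorname{IPPM}$ is the set of partition matrices all of whose descents and ascents are improper. The semi-weight of a partition matrix $P$ of dimension $D$ is $v(P)=\sum_{d=1}^{D}\lceil n_d/2\rceil$, where $n_d$ is the number of elements lying in the $d$-th column. -}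

module Defs where

open import Data.Bool using (Bool; true; false; _∧_; _∨_; not; if_then_else_)
open import Data.Nat using (ℕ; zero; suc; _+_; _*_; _≡ᵇ_; _≤ᵇ_; _<ᵇ_; _%_; ⌈_/2⌉)
open import Data.Integer as ℤ using (ℤ; +_; -[1+_])
open import Data.Fin using (Fin; toℕ)
open import Data.Product using (Σ; _×_; _,_; proj₁)
open import Data.List using (List; []; _∷_; map; concatMap; all; any; upTo; allFin; cartesianProduct)
open import Data.Nat.ListAction using (sum)
open import Data.Vec using (Vec; []; _∷_)
open import Relation.Nullary.Decidable using (does)

-- A matrix of dimension D (rows/columns indexed 0..D-1) on [n] is
-- encoded by the vector assigning to each k ∈ [n] (the k-th component)
-- the position (row(k), col(k)) of the entry containing k.  The entry
-- at (r,c) is then {k | (row k, col k) = (r,c)}; the nonempty entries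
-- automatically form a set partition of [n], and the matrix is
-- determined by this assignment.

Cand : ℕ → Set
Cand n = Σ ℕ (λ D → Vec (Fin D × Fin D) n)

allVecs : {A : Set} → List A → (n : ℕ) → List (Vec A n)
allVecs xs zero    = [] ∷ []
allVecs xs (suc n) = concatMap (λ x → map (x ∷_) (allVecs xs n)) xs

-- all candidates of weight n with 1 ≤ D ≤ n
-- (a partition matrix on [n] has at most n rows, since every row
--  contains a nonempty entry and these are disjoint subsets of [n])
candidates : (n : ℕ) → List (Cand n)
candidates n = concatMap (λ D → map (λ v → (suc D , v))
                   (allVecs (cartesianProduct (allFin (suc D)) (allFin (suc D))) n))
                 (upTo n)

-- list of triples (k , row k , col k), k = 1..n (rows/cols 0-based)
label : {D m : ℕ} → ℕ → Vec (Fin D × Fin D) m → List (ℕ × ℕ × ℕ)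
label s []              = []
label s ((r , c) ∷ v)   = (s , toℕ r , toℕ c) ∷ label (suc s) v

entries : {n : ℕ} → Cand n → List (ℕ × ℕ × ℕ)
entries (D , v) = label 1 v

dimC : {n : ℕ} → Cand n → ℕ
dimC = proj₁

rowOf colOf : ℕ × ℕ × ℕ → ℕ
rowOf (_ , r , _) = r
colOf (_ , _ , c) = c

eltOf : ℕ × ℕ × ℕ → ℕ
eltOf (k , _ , _) = k

isPM : {n : ℕ} → Cand n → Bool
isPM P =
  let es = entries P ; D = dimC P in
  all (λ e → rowOf e ≤ᵇ colOf e) es
  ∧ all (λ r → any (λ e → rowOf e ≡ᵇ r) es) (upTo D)
  ∧ all (λ c → any (λ e → colOf e ≡ᵇ c) es) (upTo D)
  ∧ all (λ e → all (λ e' → not (colOf e <ᵇ colOf e') ∨ (eltOf e <ᵇ eltOf e')) es) es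

colSize : List (ℕ × ℕ × ℕ) → ℕ → ℕ
colSize es c = sum (map (λ e → if colOf e ≡ᵇ c then 1 else 0) es)

-- minimal element lying in column c (0 if the column is empty);
-- _⊓'_ is min on positive numbers with 0 treated as "none"
_⊓'_ : ℕ → ℕ → ℕ
zero ⊓' m = m
suc k ⊓' zero = suc k
suc k ⊓' suc m = suc (k Data.Nat.⊓ m)

minInCol : List (ℕ × ℕ × ℕ) → ℕ → ℕ
minInCol []       c = zero
minInCol (e ∷ es) c = if colOf e ≡ᵇ c then eltOf e ⊓' minInCol es c else minInCol es c

semiWeight : {n : ℕ} → Cand n → ℕ
semiWeight P = sum (map (λ d → ⌈ colSize (entries P) d /2⌉) (upTo (dimC P)))

consecutive : {A : Set} → List A → List (A × A)
consecutive []           = []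
consecutive (x ∷ [])     = []
consecutive (x ∷ y ∷ xs) = (x , y) ∷ consecutive (y ∷ xs)

properDA : List (ℕ × ℕ × ℕ) → (ℕ × ℕ × ℕ) × (ℕ × ℕ × ℕ) → Bool
properDA es (e , e') =
  (1 <ᵇ eltOf e) ∧ (colOf e ≡ᵇ colOf e') ∧ not (rowOf e ≡ᵇ rowOf e')
  ∧ (eltOf e % 2 ≡ᵇ minInCol es (colOf e) % 2)

allImproper : {n : ℕ} → Cand n → Bool
allImproper P = let es = entries P in all (λ p → not (properDA es p)) (consecutive es)

isIPPM : {n : ℕ} → Cand n → Bool
isIPPM P = isPM P ∧ allImproper P

countL : {A : Set} → (A → Bool) → List A → ℕ
countL p xs = sum (map (λ x → if p x then 1 else 0) xs)

Laurent : Set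
Laurent = ℤ → ℕ

tPow : ℤ → Laurent
tPow k e = if does (e ℤ.≟ k) then 1 else 0

mulOnePlusInvT : Laurent → Laurent
mulOnePlusInvT f e = f e + f (e ℤ.+ + 1)

mulPow : ℕ → Laurent → Laurent
mulPow zero    f = f
mulPow (suc D) f = mulOnePlusInvT (mulPow D f)

lhsCoeff : ℕ → ℤ → ℕ
lhsCoeff a (+ b)    = countL (λ Q → isIPPM Q ∧ (semiWeight Q ≡ᵇ a)) (candidates b)
lhsCoeff a -[1+ _ ] = 0

rhsCoeff : ℕ → ℤ → ℕ
rhsCoeff a b = sum (map (λ P → if isPM P then mulPow (dimC P) (tPow (+ (2 * a))) b else 0)
                        (candidates a))

-- In an IPPM, within each column the entries at even distance from the least
-- element pair up with their successors: a proper descent or ascent is exactly a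
-- change of row inside such a pair (in the first column, where 1 is exempt, upper
-- triangularity leaves only row 0 anyway).  Collapsing every pair, and every
-- unpaired last entry of a column, to a single entry turns an IPPM Q into a
-- partition matrix P of the same dimension with w(P) = v(Q), and Q is recovered
-- from P and the parities of the column sizes of Q.  A column of P contributes t² per
-- entry, except that its last entry contributes t² or t according to that parity,
-- whence t^(2w(P)) (1 + t⁻¹)^dim(P).
--
-- The bijection is realised by reading matrices entry by entry.  The right side
-- satisfies a recursion in which each entry of a partition matrix weighs t², or
-- t + t² if it is the last of its column.  The number of IPPM completions, given
-- whether the pair of the current entry is still open, is a coefficient of the
-- same recursion, by induction on the number of entries still to be placed.

module Submission where

open import Defs
open import Data.Bool using (Bool; true; false; _∧_; _∨_; not; if_then_else_; T)
open import Data.Bool.Properties using (T-≡; T-∨; T-∧; ∧-zeroʳ; ∧-identityʳ; ∨-identityʳ; ∨-zeroʳ; ∨-assoc; not-involutive)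
open import Data.Bool.Solver using (module ∨-∧-Solver)
open import Data.Empty using (⊥-elim)
open import Data.Fin using (Fin; toℕ)
open import Data.Fin.Properties using (toℕ<n)
open import Data.Integer as ℤ using (ℤ; +_; -[1+_])
import Data.Integer.Properties as ℤ
open import Algebra.Properties.AbelianGroup ℤ.+-0-abelianGroup using (∙-cancelʳ)
open import Data.List using (List; []; _∷_; map; concatMap; all; any; upTo; allFin; cartesianProduct; _++_; applyUpTo; tabulate)
open import Data.List.Properties using (map-++; map-cong; map-∘; map-tabulate; map-applyUpTo; applyUpTo-∷ʳ)
open import Data.List.Membership.Propositional using (_∈_)
open import Data.List.Membership.Propositional.Properties using (∈-upTo⁺; ∈-upTo⁻)
open import Data.List.Relation.Unary.All as All using (All)
open import Data.List.Relation.Unary.All.Properties using (all⁺; all⁻)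
open import Data.List.Relation.Unary.Any using (here; there)
open import Data.List.Relation.Unary.Any.Properties using (any⁻)
open import Data.Nat as ℕ
  using (ℕ; zero; suc; _+_; _*_; _∸_; _≤_; _<_; z≤n; s≤s; _≤ᵇ_; _<ᵇ_; _≡ᵇ_; _%_; ⌈_/2⌉; compare; less; equal; greater)
open import Data.Nat.ListAction using (sum)
open import Data.Nat.ListAction.Properties using (sum-++)
open import Data.Nat.Properties
open import Algebra.Properties.CommutativeSemigroup +-commutativeSemigroup using (interchange; xy∙z≈xz∙y)
open import Data.Product using (_×_; _,_; proj₁; proj₂)
open import Data.Sum using (_⊎_; inj₁; inj₂)
open import Data.Vec using (Vec; []; _∷_)
open import Function using (_∘_; id; Equivalence; mk⇔)
open import Relation.Binary.Definitions using (tri<; tri≈; tri>)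
open import Relation.Binary.PropositionalEquality
open import Relation.Nullary using (¬_; yes; no; contradiction)
open import Relation.Nullary.Decidable using (does-⇔; dec-false)

module _ {A : Set} where

  sum-map-cong : {f g : A → ℕ} (xs : List A) → (∀ x → f x ≡ g x) → sum (map f xs) ≡ sum (map g xs)
  sum-map-cong xs f≗g = cong sum (map-cong f≗g xs)

  sum-map-zero : {f : A → ℕ} (xs : List A) → (∀ x → f x ≡ 0) → sum (map f xs) ≡ 0
  sum-map-zero []       f≗0 = refl
  sum-map-zero (x ∷ xs) f≗0 = cong₂ _+_ (f≗0 x) (sum-map-zero xs f≗0)

  sum-map-++ : (f : A → ℕ) (xs ys : List A) → sum (map f (xs ++ ys)) ≡ sum (map f xs) + sum (map f ys)
  sum-map-++ f xs ys = trans (cong sum (map-++ f xs ys)) (sum-++ (map f xs) (map f ys))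

  sum-map-*ʳ : (f : A → ℕ) (k : ℕ) (xs : List A) → sum (map (λ x → f x * k) xs) ≡ sum (map f xs) * k
  sum-map-*ʳ f k []       = refl
  sum-map-*ʳ f k (x ∷ xs) = trans (cong (_+_ (f x * k)) (sum-map-*ʳ f k xs)) (sym (*-distribʳ-+ k (f x) _))

  sum-map-+ : (f g : A → ℕ) (xs : List A) → sum (map (λ x → f x + g x) xs) ≡ sum (map f xs) + sum (map g xs)
  sum-map-+ f g []       = refl
  sum-map-+ f g (x ∷ xs) = trans (cong (_+_ (f x + g x)) (sum-map-+ f g xs)) (interchange (f x) (g x) _ _)

sum-map-∘ : {A B : Set} (f : B → ℕ) (g : A → B) (xs : List A) → sum (map f (map g xs)) ≡ sum (map (f ∘ g) xs)
sum-map-∘ f g xs = cong sum (sym (map-∘ xs))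

module _ {A B : Set} where

  sum-map-concatMap : (f : B → ℕ) (g : A → List B) (xs : List A) →
    sum (map f (concatMap g xs)) ≡ sum (map (λ x → sum (map f (g x))) xs)
  sum-map-concatMap f g []       = refl
  sum-map-concatMap f g (x ∷ xs) =
    trans (sum-map-++ f (g x) (concatMap g xs)) (cong (_+_ (sum (map f (g x)))) (sum-map-concatMap f g xs))

  sum-map-cartesianProduct : (h : A × B → ℕ) (xs : List A) (ys : List B) →
    sum (map h (cartesianProduct xs ys)) ≡ sum (map (λ x → sum (map (λ y → h (x , y)) ys)) xs)
  sum-map-cartesianProduct h []       ys = refl
  sum-map-cartesianProduct h (x ∷ xs) ys = trans (sum-map-++ h (map (x ,_) ys) (cartesianProduct xs ys))
    (cong₂ _+_ (sum-map-∘ h (x ,_) ys) (sum-map-cartesianProduct h xs ys))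

module _ {A : Set} where

  countL-cong : {p q : A → Bool} (xs : List A) → (∀ x → p x ≡ q x) → countL p xs ≡ countL q xs
  countL-cong xs p≗q = sum-map-cong xs (λ x → cong (if_then 1 else 0) (p≗q x))

  sum-if≡countL* : (p : A → Bool) (k : ℕ) (xs : List A) →
    sum (map (λ x → if p x then k else 0) xs) ≡ countL p xs * k
  sum-if≡countL* p k xs = trans (sum-map-cong xs if≡if*) (sum-map-*ʳ (λ x → if p x then 1 else 0) k xs)
    where
    if≡if* : ∀ x → (if p x then k else 0) ≡ (if p x then 1 else 0) * k
    if≡if* x with p x
    ... | true  = sym (+-identityʳ k)
    ... | false = refl

countL-allVecs-∷ : {A : Set} (xs : List A) (n : ℕ) {p : Vec A (suc n) → Bool} (g : A → Bool) (q : A → Vec A n → Bool) →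
  (∀ x v → p (x ∷ v) ≡ g x ∧ q x v) →
  countL p (allVecs xs (suc n)) ≡ sum (map (λ x → if g x then countL (q x) (allVecs xs n) else 0) xs)
countL-allVecs-∷ xs n {p} g q split = trans (sum-map-concatMap _ _ xs) (sum-map-cong xs count-∷)
  where
  count-∷ : ∀ x → sum (map (λ v → if p v then 1 else 0) (map (x ∷_) (allVecs xs n)))
                  ≡ (if g x then countL (q x) (allVecs xs n) else 0)
  count-∷ x with g x in gx
  ... | true  = trans (sum-map-∘ _ (x ∷_) (allVecs xs n))
                  (countL-cong (allVecs xs n) (λ v → trans (split x v) (cong (_∧ q x v) gx)))
  ... | false = trans (sum-map-∘ _ (x ∷_) (allVecs xs n))
                  (sum-map-zero (allVecs xs n) (λ v → cong (if_then 1 else 0) (trans (split x v) (cong (_∧ q x v) gx))))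

Σ< : ℕ → (ℕ → ℕ) → ℕ
Σ< n f = sum (map f (upTo n))

module _ {n : ℕ} where

  Σ<-cong : {f g : ℕ → ℕ} → (∀ i → i < n → f i ≡ g i) → Σ< n f ≡ Σ< n g
  Σ<-cong {f} {g} f≗g = sum-map-cong-∈ (upTo n) (λ i∈ → f≗g _ (∈-upTo⁻ i∈))
    where
    sum-map-cong-∈ : (xs : List ℕ) → (∀ {i} → i ∈ xs → f i ≡ g i) → sum (map f xs) ≡ sum (map g xs)
    sum-map-cong-∈ []       _   = refl
    sum-map-cong-∈ (x ∷ xs) f≗g = cong₂ _+_ (f≗g (here refl)) (sum-map-cong-∈ xs (f≗g ∘ there))

  Σ<-zero : {f : ℕ → ℕ} → (∀ i → i < n → f i ≡ 0) → Σ< n f ≡ 0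
  Σ<-zero f≗0 = trans (Σ<-cong f≗0) (sum-map-zero (upTo n) (λ _ → refl))

Σ<-+ : (n : ℕ) (f g : ℕ → ℕ) → Σ< n (λ i → f i + g i) ≡ Σ< n f + Σ< n g
Σ<-+ n f g = sum-map-+ f g (upTo n)

Σ<-*ʳ : (n : ℕ) (f : ℕ → ℕ) (k : ℕ) → Σ< n (λ i → f i * k) ≡ Σ< n f * k
Σ<-*ʳ n f k = sum-map-*ʳ f k (upTo n)

Σ<-suc : (n : ℕ) (f : ℕ → ℕ) → Σ< (suc n) f ≡ Σ< n f + f n
Σ<-suc n f = begin
  sum (map f (upTo (suc n)))              ≡⟨ cong (sum ∘ map f) (sym (applyUpTo-∷ʳ id n)) ⟩
  sum (map f (upTo n ++ n ∷ []))          ≡⟨ sum-map-++ f (upTo n) (n ∷ []) ⟩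
  Σ< n f + (f n + 0)                      ≡⟨ cong (_+_ (Σ< n f)) (+-identityʳ (f n)) ⟩
  Σ< n f + f n                            ∎
  where open ≡-Reasoning

Σ<-update : (n c δ : ℕ) {f g : ℕ → ℕ} → c < n → (∀ d → d < n → d ≢ c → f d ≡ g d) → f c ≡ g c + δ →
  Σ< n f ≡ Σ< n g + δ
Σ<-update (suc n) c δ {f} {g} c<1+n others fc with c ≟ n
... | yes refl = begin
  Σ< (suc c) f           ≡⟨ Σ<-suc c f ⟩
  Σ< c f + f c           ≡⟨ cong₂ _+_ (Σ<-cong (λ d d<c → others d (m<n⇒m<1+n d<c) (<⇒≢ d<c))) fc ⟩
  Σ< c g + (g c + δ)     ≡⟨ sym (+-assoc (Σ< c g) (g c) δ) ⟩
  Σ< c g + g c + δ       ≡⟨ cong (_+ δ) (sym (Σ<-suc c g)) ⟩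
  Σ< (suc c) g + δ       ∎
  where open ≡-Reasoning
... | no c≢n = begin
  Σ< (suc n) f           ≡⟨ Σ<-suc n f ⟩
  Σ< n f + f n           ≡⟨ cong₂ _+_ (Σ<-update n c δ (≤∧≢⇒< (≤-pred c<1+n) c≢n) (λ d d<n → others d (m<n⇒m<1+n d<n)) fc)
                                      (others n ≤-refl (c≢n ∘ sym)) ⟩
  Σ< n g + δ + g n       ≡⟨ xy∙z≈xz∙y (Σ< n g) δ (g n) ⟩
  Σ< n g + g n + δ       ≡⟨ cong (_+ δ) (sym (Σ<-suc n g)) ⟩
  Σ< (suc n) g + δ       ∎
  where open ≡-Reasoning

Σ<-single : (n j : ℕ) {f : ℕ → ℕ} → j < n → (∀ i → i < n → i ≢ j → f i ≡ 0) → Σ< n f ≡ f j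
Σ<-single n j j<n others = trans (Σ<-update n j _ j<n others refl) (cong (_+ _) (Σ<-zero {n} (λ _ _ → refl)))

Σ<-truncate : (n m : ℕ) {f : ℕ → ℕ} → n ≤ m → (∀ i → n ≤ i → i < m → f i ≡ 0) → Σ< m f ≡ Σ< n f
Σ<-truncate n zero    z≤n   vanish = refl
Σ<-truncate n (suc m) {f} n≤1+m vanish with m≤n⇒m<n∨m≡n n≤1+m
... | inj₂ refl = refl
... | inj₁ n<1+m = begin
  Σ< (suc m) f    ≡⟨ Σ<-suc m f ⟩
  Σ< m f + f m    ≡⟨ cong₂ _+_ (Σ<-truncate n m (≤-pred n<1+m) (λ i n≤i i<m → vanish i n≤i (m<n⇒m<1+n i<m)))
                               (vanish m (≤-pred n<1+m) ≤-refl) ⟩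
  Σ< n f + 0      ≡⟨ +-identityʳ _ ⟩
  Σ< n f          ∎
  where open ≡-Reasoning

Σ<-allFin : (n : ℕ) (f : ℕ → ℕ) → sum (map (f ∘ toℕ) (allFin n)) ≡ Σ< n f
Σ<-allFin n f = cong sum (trans (map-tabulate id (f ∘ toℕ)) (trans (tabulate-toℕ n f) (sym (map-applyUpTo id f n))))
  where
  tabulate-toℕ : {B : Set} (n : ℕ) (g : ℕ → B) → tabulate {n = n} (g ∘ toℕ) ≡ applyUpTo g n
  tabulate-toℕ zero    g = refl
  tabulate-toℕ (suc n) g = cong (g 0 ∷_) (tabulate-toℕ n (g ∘ suc))

T⇒≡true : {b : Bool} → T b → b ≡ true
T⇒≡true = Equivalence.to T-≡

≡true⇒T : {b : Bool} → b ≡ true → T b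
≡true⇒T = Equivalence.from T-≡

T-∧⁻ : {a b : Bool} → T (a ∧ b) → T a × T b
T-∧⁻ = Equivalence.to T-∧

¬T⇒≡false : {b : Bool} → ¬ T b → b ≡ false
¬T⇒≡false {false} _  = refl
¬T⇒≡false {true}  ¬t = ⊥-elim (¬t _)

≡ᵇ-refl : (n : ℕ) → (n ≡ᵇ n) ≡ true
≡ᵇ-refl n = T⇒≡true (≡⇒≡ᵇ n n refl)

≢⇒≡ᵇ-false : {m n : ℕ} → m ≢ n → (m ≡ᵇ n) ≡ false
≢⇒≡ᵇ-false {m} {n} m≢n = ¬T⇒≡false (m≢n ∘ ≡ᵇ⇒≡ m n)

<⇒<ᵇ-true : {m n : ℕ} → m < n → (m <ᵇ n) ≡ true
<⇒<ᵇ-true m<n = T⇒≡true (<⇒<ᵇ m<n)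

≤⇒<ᵇ-false : {m n : ℕ} → n ≤ m → (m <ᵇ n) ≡ false
≤⇒<ᵇ-false {m} {n} n≤m = ¬T⇒≡false (λ t → <⇒≱ (<ᵇ⇒< m n t) n≤m)

not-<ᵇ : (m n : ℕ) → not (m <ᵇ n) ≡ (n ≤ᵇ m)
not-<ᵇ m       zero    = refl
not-<ᵇ zero    (suc n) = refl
not-<ᵇ (suc m) (suc n) = trans (not-<ᵇ m n) (<ᵇ-suc n m)
  where
  <ᵇ-suc : ∀ n m → (n ≤ᵇ m) ≡ (n <ᵇ suc m)
  <ᵇ-suc zero    m = refl
  <ᵇ-suc (suc n) m = refl

module _ {A : Set} where

  all-cong-∈ : {p q : A → Bool} (xs : List A) → (∀ {x} → x ∈ xs → p x ≡ q x) → all p xs ≡ all q xs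
  all-cong-∈ []       _   = refl
  all-cong-∈ (x ∷ xs) p≗q = cong₂ _∧_ (p≗q (here refl)) (all-cong-∈ xs (p≗q ∘ there))

  all-true : {p : A → Bool} (xs : List A) → (∀ {x} → x ∈ xs → T (p x)) → all p xs ≡ true
  all-true xs holds = T⇒≡true (all⁻ _ (All.tabulate holds))

  all-∈ : {p : A → Bool} {xs : List A} → T (all p xs) → ∀ {x} → x ∈ xs → T (p x)
  all-∈ {p} {xs} t = All.lookup (all⁺ p xs t)

  all-∧ : (p q : A → Bool) (xs : List A) → all (λ x → p x ∧ q x) xs ≡ all p xs ∧ all q xs
  all-∧ p q []       = refl
  all-∧ p q (x ∷ xs) = trans (cong (_∧_ (p x ∧ q x)) (all-∧ p q xs)) (interchange-∧ (p x) (q x) (all p xs) (all q xs))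
    where
    open ∨-∧-Solver using (solve; _:*_; _:=_)
    interchange-∧ : ∀ a b c d → (a ∧ b) ∧ (c ∧ d) ≡ (a ∧ c) ∧ (b ∧ d)
    interchange-∧ = solve 4 (λ a b c d → (a :* b) :* (c :* d) := (a :* c) :* (b :* d)) refl

if-same : {A : Set} (b : Bool) (x : A) → (if b then x else x) ≡ x
if-same true  x = refl
if-same false x = refl

∧-congˡ-T : {a b b′ : Bool} → (T a → b ≡ b′) → a ∧ b ≡ a ∧ b′
∧-congˡ-T {false} _  = refl
∧-congˡ-T {true}  eq = eq _

-- Tails of partition matrices

-- (element, row, column), as produced by label.
Entry : Set
Entry = ℕ × ℕ × ℕ

RowSet : Set
RowSet = ℕ → Bool

∅ : RowSet
∅ _ = false

_∪_ : RowSet → ℕ → RowSet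
(U ∪ r) ρ = U ρ ∨ (r ≡ᵇ ρ)

_≐_ : RowSet → RowSet → Set
U ≐ U′ = ∀ ρ → U ρ ≡ U′ ρ

∪-resp-≐ : {U U′ : RowSet} (i : ℕ) → U ≐ U′ → (U ∪ i) ≐ (U′ ∪ i)
∪-resp-≐ i U≐U′ ρ = cong (_∨ (i ≡ᵇ ρ)) (U≐U′ ρ)

∪-absorb : {U : RowSet} {i : ℕ} → U i ≡ true → (U ∪ i) ≐ U
∪-absorb {U} {i} Ui ρ with i ≟ ρ
... | yes refl rewrite Ui = refl
... | no i≢ρ rewrite ≢⇒≡ᵇ-false i≢ρ = ∨-identityʳ (U ρ)

label-elt : {D n : ℕ} (s : ℕ) (v : Vec (Fin D × Fin D) n) {e : Entry} → e ∈ label s v → s ≤ eltOf e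
label-elt s (_ ∷ v) (here refl) = ≤-refl
label-elt s (_ ∷ v) (there e∈)  = <⇒≤ (label-elt (suc s) v e∈)

module PMTail (N : ℕ) where

  upperTriangular : List Entry → Bool
  upperTriangular = all (λ e → rowOf e ≤ᵇ colOf e)

  rowsCovered : RowSet → List Entry → Bool
  rowsCovered U es = all (λ ρ → U ρ ∨ any (λ e → rowOf e ≡ᵇ ρ) es) (upTo N)

  colsCoveredFrom : ℕ → List Entry → Bool
  colsCoveredFrom k es = all (λ d → (d <ᵇ k) ∨ any (λ e → colOf e ≡ᵇ d) es) (upTo N)

  colOrdered : Entry → Entry → Bool
  colOrdered e e′ = not (colOf e <ᵇ colOf e′) ∨ (eltOf e <ᵇ eltOf e′)

  colsOrdered : List Entry → Bool
  colsOrdered es = all (λ e → all (colOrdered e) es) es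

  colsFrom : ℕ → List Entry → Bool
  colsFrom c = all (λ e → c ≤ᵇ colOf e)

  -- pmTail U k es: the entries es complete a prefix which used the rows in U and
  -- exactly the columns 0, …, k − 1 to a partition matrix of dimension N
  -- (for k = 0, the truncated k ∸ 1 makes colsFrom vacuous).
  pmTail : RowSet → ℕ → List Entry → Bool
  pmTail U k es = upperTriangular es ∧ rowsCovered U es ∧ colsCoveredFrom k es ∧ colsOrdered es ∧ colsFrom (k ∸ 1) es

  nextEntryOk : ℕ → ℕ → ℕ → Bool
  nextEntryOk k r c = (r ≤ᵇ c) ∧ (k ∸ 1 ≤ᵇ c) ∧ (c ≤ᵇ k)

  isPM≡pmTail : {n : ℕ} (v : Vec (Fin N × Fin N) n) → isPM (N , v) ≡ pmTail ∅ 0 (label 1 v)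
  isPM≡pmTail v = cong (λ b → upperTriangular es ∧ rowsCovered ∅ es ∧ colsCoveredFrom 0 es ∧ b)
    (sym (trans (cong (colsOrdered es ∧_) (all-true es (λ _ → _))) (∧-identityʳ _)))
    where es = label 1 v

  covered-step : {c k : ℕ} → c ≤ k → k ≤ suc c → (d : ℕ) (X : Bool) →
    (d <ᵇ k) ∨ ((c ≡ᵇ d) ∨ X) ≡ (d <ᵇ suc c) ∨ X
  covered-step {c} {k} c≤k k≤1+c d X with <-cmp d c
  ... | tri< d<c _ _ rewrite <⇒<ᵇ-true (<-≤-trans d<c c≤k) | <⇒<ᵇ-true (m<n⇒m<1+n d<c) = refl
  ... | tri≈ _ refl _ rewrite ≡ᵇ-refl d | <⇒<ᵇ-true (n<1+n d) = ∨-zeroʳ (d <ᵇ k)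
  ... | tri> _ _ c<d rewrite ≤⇒<ᵇ-false (≤-trans k≤1+c c<d) | ≢⇒≡ᵇ-false (<⇒≢ c<d) | ≤⇒<ᵇ-false c<d = refl

  module _ (s r c : ℕ) (rest : List Entry) (later : ∀ {e} → e ∈ rest → s < eltOf e) where

    private
      e₀ : Entry
      e₀ = (s , r , c)

    rowsCovered-∷ : (U : RowSet) → rowsCovered U (e₀ ∷ rest) ≡ rowsCovered (U ∪ r) rest
    rowsCovered-∷ U = all-cong-∈ (upTo N) (λ {ρ} _ → sym (∨-assoc (U ρ) (r ≡ᵇ ρ) _))

    colsOrdered-∷ : colsOrdered (e₀ ∷ rest) ≡ colsFrom c rest ∧ colsOrdered rest
    colsOrdered-∷ = begin
        (colOrdered e₀ e₀ ∧ all (colOrdered e₀) rest) ∧ all (λ e → colOrdered e e₀ ∧ all (colOrdered e) rest) rest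
      ≡⟨ cong₂ (λ a b → (a ∧ b) ∧ all (λ e → colOrdered e e₀ ∧ all (colOrdered e) rest) rest) e₀-ordered e₀-first ⟩
        all (λ e → colOrdered e e₀ ∧ all (colOrdered e) rest) rest
      ≡⟨ all-∧ (λ e → colOrdered e e₀) (λ e → all (colOrdered e) rest) rest ⟩
        all (λ e → colOrdered e e₀) rest ∧ colsOrdered rest
      ≡⟨ cong (_∧ colsOrdered rest) (all-cong-∈ rest later-ordered) ⟩
        colsFrom c rest ∧ colsOrdered rest
      ∎
      where
      open ≡-Reasoning
      e₀-ordered : colOrdered e₀ e₀ ≡ true
      e₀-ordered rewrite ≤⇒<ᵇ-false (≤-refl {c}) = refl
      e₀-first : all (colOrdered e₀) rest ≡ true
      e₀-first = all-true rest (λ e∈ → Equivalence.from T-∨ (inj₂ (<⇒<ᵇ (later e∈))))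
      later-ordered : ∀ {e} → e ∈ rest → colOrdered e e₀ ≡ (c ≤ᵇ colOf e)
      later-ordered {e} e∈ rewrite ≤⇒<ᵇ-false (<⇒≤ (later e∈)) = trans (∨-identityʳ _) (not-<ᵇ (colOf e) c)

    module _ (cols-later : T (colsFrom c rest)) {k : ℕ} (k∸1≤c : k ∸ 1 ≤ c) where

      colsFrom-rest : colsFrom (k ∸ 1) rest ≡ true
      colsFrom-rest = all-true rest (λ {e} e∈ → ≤⇒≤ᵇ (≤-trans k∸1≤c (≤ᵇ⇒≤ c (colOf e) (all-∈ cols-later e∈))))

      colsCoveredFrom-∷ : c < N → colsCoveredFrom k (e₀ ∷ rest) ≡ (c ≤ᵇ k) ∧ colsCoveredFrom (suc c) rest
      colsCoveredFrom-∷ c<N with c ≤? k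
      ... | yes c≤k rewrite T⇒≡true (≤⇒≤ᵇ c≤k) =
        all-cong-∈ (upTo N) (λ {d} _ → covered-step c≤k (≤-trans (m≤n+m∸n k 1) (s≤s k∸1≤c)) d _)
      ... | no c≰k rewrite ¬T⇒≡false (c≰k ∘ ≤ᵇ⇒≤ c k) =
        ¬T⇒≡false (λ t → column-k-empty (all-∈ t (∈-upTo⁺ (<-trans k<c c<N))))
        where
        k<c : k < c
        k<c = ≰⇒> c≰k
        column-k-empty : ¬ T ((k <ᵇ k) ∨ ((c ≡ᵇ k) ∨ any (λ e → colOf e ≡ᵇ k) rest))
        column-k-empty t with Equivalence.to T-∨ t
        ... | inj₁ k<k = <-irrefl refl (<ᵇ⇒< k k k<k)
        ... | inj₂ t′ with Equivalence.to T-∨ t′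
        ...   | inj₁ c≡k = <-irrefl (sym (≡ᵇ⇒≡ c k c≡k)) k<c
        ...   | inj₂ in-rest = All.lookupWith
                  (λ {e} c≤col col≡k → <⇒≱ k<c (subst (c ≤_) (≡ᵇ⇒≡ (colOf e) k col≡k) (≤ᵇ⇒≤ c (colOf e) c≤col)))
                  (all⁺ _ rest cols-later) (any⁻ _ rest in-rest)

    pmTail-∷ : (U : RowSet) (k : ℕ) → c < N → pmTail U k (e₀ ∷ rest) ≡ nextEntryOk k r c ∧ pmTail (U ∪ r) (suc c) rest
    pmTail-∷ U k c<N = begin
        (r≤c ∧ upper) ∧ rowsCovered U (e₀ ∷ rest) ∧ cols₀ ∧ colsOrdered (e₀ ∷ rest) ∧ (k-1≤c ∧ from-k-1)
      ≡⟨ cong₂ (λ w o → (r≤c ∧ upper) ∧ w ∧ cols₀ ∧ o ∧ (k-1≤c ∧ from-k-1)) (rowsCovered-∷ U) colsOrdered-∷ ⟩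
        (r≤c ∧ upper) ∧ rows ∧ cols₀ ∧ (from-c ∧ ordered) ∧ (k-1≤c ∧ from-k-1)
      ≡⟨ solve 8 (λ x₁ x₂ x₃ x₄ x₅ x₆ x₇ x₈ → (x₁ :* x₂) :* (x₃ :* (x₄ :* ((x₅ :* x₆) :* (x₇ :* x₈))))
                   := (x₇ :* x₅) :* (x₁ :* (x₂ :* (x₃ :* (x₄ :* (x₆ :* x₈)))))) refl
                 r≤c upper rows cols₀ from-c ordered k-1≤c from-k-1 ⟩
        (k-1≤c ∧ from-c) ∧ (r≤c ∧ upper ∧ rows ∧ cols₀ ∧ ordered ∧ from-k-1)
      ≡⟨ ∧-congˡ-T (λ t → let (t-k , t-c) = T-∧⁻ t ; k∸1≤c = ≤ᵇ⇒≤ (k ∸ 1) c t-k in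
            cong₂ (λ cs w → r≤c ∧ upper ∧ rows ∧ cs ∧ ordered ∧ w)
                  (colsCoveredFrom-∷ t-c {k} k∸1≤c c<N) (colsFrom-rest t-c {k} k∸1≤c)) ⟩
        (k-1≤c ∧ from-c) ∧ (r≤c ∧ upper ∧ rows ∧ (c≤k ∧ cols) ∧ ordered ∧ true)
      ≡⟨ solve 8 (λ x₁ x₂ x₃ x₄ x₅ x₆ x₇ x₈ →
                     (x₈ :* x₆) :* (x₁ :* (x₂ :* (x₃ :* ((x₄ :* x₅) :* (x₇ :* con true)))))
                   := (x₁ :* (x₈ :* x₄)) :* (x₂ :* (x₃ :* (x₅ :* (x₇ :* x₆))))) refl
                 r≤c upper rows c≤k cols from-c ordered k-1≤c ⟩
        nextEntryOk k r c ∧ pmTail (U ∪ r) (suc c) rest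
      ∎
      where
      open ≡-Reasoning
      open ∨-∧-Solver using (solve; _:*_; _:=_; con)
      r≤c = r ≤ᵇ c
      k-1≤c = k ∸ 1 ≤ᵇ c
      c≤k = c ≤ᵇ k
      upper = upperTriangular rest
      rows = rowsCovered (U ∪ r) rest
      cols₀ = colsCoveredFrom k (e₀ ∷ rest)
      cols = colsCoveredFrom (suc c) rest
      ordered = colsOrdered rest
      from-c = colsFrom c rest
      from-k-1 = colsFrom (k ∸ 1) rest

-- Counting partition matrices

binomT : ℕ → ℤ → Laurent
binomT n x = mulPow n (tPow x)

binomT-shift : (n : ℕ) (x e : ℤ) → binomT n (x ℤ.+ + 1) (e ℤ.+ + 1) ≡ binomT n x e
binomT-shift zero    x e = cong (if_then 1 else 0)
  (does-⇔ (mk⇔ (∙-cancelʳ (+ 1) e x) (cong (ℤ._+ + 1))) ((e ℤ.+ + 1) ℤ.≟ (x ℤ.+ + 1)) (e ℤ.≟ x))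
binomT-shift (suc n) x e = cong₂ _+_ (binomT-shift n x e) (binomT-shift n x (e ℤ.+ + 1))

binomT-shift₂ : (n : ℕ) (x e : ℤ) → binomT n (x ℤ.+ + 1 ℤ.+ + 1) e ≡ binomT n x (e ℤ.+ -[1+ 1 ])
binomT-shift₂ n x e = begin
    binomT n (x ℤ.+ + 1 ℤ.+ + 1) e
  ≡⟨ cong (binomT n (x ℤ.+ + 1 ℤ.+ + 1)) (sym e-2+1+1) ⟩
    binomT n (x ℤ.+ + 1 ℤ.+ + 1) (e ℤ.+ -[1+ 1 ] ℤ.+ + 1 ℤ.+ + 1)
  ≡⟨ binomT-shift n (x ℤ.+ + 1) (e ℤ.+ -[1+ 1 ] ℤ.+ + 1) ⟩
    binomT n (x ℤ.+ + 1) (e ℤ.+ -[1+ 1 ] ℤ.+ + 1)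
  ≡⟨ binomT-shift n x (e ℤ.+ -[1+ 1 ]) ⟩
    binomT n x (e ℤ.+ -[1+ 1 ])
  ∎
  where
  open ≡-Reasoning
  e-2+1+1 : e ℤ.+ -[1+ 1 ] ℤ.+ + 1 ℤ.+ + 1 ≡ e
  e-2+1+1 = trans (ℤ.+-assoc (e ℤ.+ -[1+ 1 ]) (+ 1) (+ 1)) (trans (ℤ.+-assoc e -[1+ 1 ] (+ 2)) (ℤ.+-identityʳ e))

twice-suc : ℕ → ℤ
twice-suc zero    = + 2
twice-suc (suc r) = twice-suc r ℤ.+ + 1 ℤ.+ + 1

twice-suc≡ : (r : ℕ) → twice-suc r ≡ + (2 * suc r)
twice-suc≡ zero    = refl
twice-suc≡ (suc r) rewrite twice-suc≡ r =
  cong +_ (trans (+-assoc (2 * suc r) 1 1) (trans (+-comm (2 * suc r) 2) (sym (*-suc 2 (suc r)))))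

∸-suc-pred : (n j : ℕ) → j < n → n ∸ j ≡ suc (n ∸ suc j)
∸-suc-pred (suc n) zero    _         = refl
∸-suc-pred (suc n) (suc j) (s≤s j<n) = ∸-suc-pred n j j<n

bounded⇒≤ : (n k : ℕ) → (∀ d → d < n → d < k) → n ≤ k
bounded⇒≤ zero    k _       = z≤n
bounded⇒≤ (suc n) k bounded = bounded n ≤-refl

module PMCount (N : ℕ) where
  open PMTail N public

  positions : List (Fin N × Fin N)
  positions = cartesianProduct (allFin N) (allFin N)

  ΣΣ : (ℕ → ℕ → ℕ) → ℕ
  ΣΣ F = Σ< N (λ i → Σ< N (F i))

  sum-positions : (F : ℕ → ℕ → ℕ) → sum (map (λ x → F (toℕ (proj₁ x)) (toℕ (proj₂ x))) positions) ≡ ΣΣ F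
  sum-positions F = trans (sum-map-cartesianProduct _ (allFin N) (allFin N))
    (trans (sum-map-cong (allFin N) (λ i → Σ<-allFin N (F (toℕ i)))) (Σ<-allFin N (λ i → Σ< N (F i))))

  ΣΣ-cong : {F G : ℕ → ℕ → ℕ} → (∀ i j → i < N → j < N → F i j ≡ G i j) → ΣΣ F ≡ ΣΣ G
  ΣΣ-cong F≗G = Σ<-cong (λ i i<N → Σ<-cong (λ j j<N → F≗G i j i<N j<N))

  ΣΣ-zero : {F : ℕ → ℕ → ℕ} → (∀ i j → i < N → j < N → F i j ≡ 0) → ΣΣ F ≡ 0
  ΣΣ-zero F≗0 = Σ<-zero (λ i i<N → Σ<-zero (λ j j<N → F≗0 i j i<N j<N))

  ΣΣ-*ʳ : (F : ℕ → ℕ → ℕ) (k : ℕ) → ΣΣ (λ i j → F i j * k) ≡ ΣΣ F * k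
  ΣΣ-*ʳ F k = trans (sum-map-cong (upTo N) (λ i → Σ<-*ʳ N (F i) k)) (Σ<-*ʳ N (λ i → Σ< N (F i)) k)

  ΣΣ-+ : (F G : ℕ → ℕ → ℕ) → ΣΣ (λ i j → F i j + G i j) ≡ ΣΣ F + ΣΣ G
  ΣΣ-+ F G = trans (sum-map-cong (upTo N) (λ i → Σ<-+ N (F i) (G i))) (Σ<-+ N _ _)

  ΣΣ-single : (i₀ j₀ : ℕ) {F : ℕ → ℕ → ℕ} → i₀ < N → j₀ < N →
    (∀ i j → i < N → j < N → (i ≢ i₀ ⊎ j ≢ j₀) → F i j ≡ 0) → ΣΣ F ≡ F i₀ j₀
  ΣΣ-single i₀ j₀ i₀<N j₀<N off = trans
    (Σ<-single N i₀ i₀<N (λ i i<N i≢i₀ → Σ<-zero (λ j j<N → off i j i<N j<N (inj₁ i≢i₀))))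
    (Σ<-single N j₀ j₀<N (λ j j<N j≢j₀ → off i₀ j i₀<N j<N (inj₂ j≢j₀)))

  pmTail-label-∷ : (U : RowSet) (k s : ℕ) {n : ℕ} (x : Fin N × Fin N) (v : Vec (Fin N × Fin N) n) →
    pmTail U k (label s (x ∷ v)) ≡
      nextEntryOk k (toℕ (proj₁ x)) (toℕ (proj₂ x)) ∧ pmTail (U ∪ toℕ (proj₁ x)) (suc (toℕ (proj₂ x))) (label (suc s) v)
  pmTail-label-∷ U k s (r , c) v = pmTail-∷ s (toℕ r) (toℕ c) (label (suc s) v) (label-elt (suc s) v) U k (toℕ<n c)

  pmTail-resp-≐ : {U U′ : RowSet} (k : ℕ) (es : List Entry) → U ≐ U′ → pmTail U k es ≡ pmTail U′ k es
  pmTail-resp-≐ k es U≐U′ = cong (λ b → upperTriangular es ∧ b ∧ colsCoveredFrom k es ∧ colsOrdered es ∧ colsFrom (k ∸ 1) es)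
    (all-cong-∈ (upTo N) (λ {ρ} _ → cong (_∨ _) (U≐U′ ρ)))

  pmTail-[]⇒N≤k : (U : RowSet) (k : ℕ) → T (pmTail U k []) → N ≤ k
  pmTail-[]⇒N≤k U k t = bounded⇒≤ N k (λ d d<N →
    <ᵇ⇒< d k (subst T (∨-identityʳ (d <ᵇ k)) (all-∈ covered (∈-upTo⁺ d<N))))
    where
    covered : T (colsCoveredFrom k [])
    covered = proj₁ (T-∧⁻ {colsCoveredFrom k []} (proj₂ (T-∧⁻ {rowsCovered U []} (proj₂ (T-∧⁻ {upperTriangular []} t)))))

  nextEntryOk⁻ : (k i j : ℕ) → T (nextEntryOk k i j) → i ≤ j × k ∸ 1 ≤ j × j ≤ k
  nextEntryOk⁻ k i j t with T-∧⁻ t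
  ... | i≤j , t′ with T-∧⁻ t′
  ...   | k∸1≤j , j≤k = ≤ᵇ⇒≤ i j i≤j , ≤ᵇ⇒≤ (k ∸ 1) j k∸1≤j , ≤ᵇ⇒≤ j k j≤k

  nextEntryOk⁺ : (k i j : ℕ) → i ≤ j → k ∸ 1 ≤ j → j ≤ k → nextEntryOk k i j ≡ true
  nextEntryOk⁺ k i j i≤j k∸1≤j j≤k rewrite T⇒≡true (≤⇒≤ᵇ i≤j) | T⇒≡true (≤⇒≤ᵇ k∸1≤j) = T⇒≡true (≤⇒≤ᵇ j≤k)

  pmCount : RowSet → ℕ → ℕ → ℕ
  pmCount U k zero    = if pmTail U k [] then 1 else 0
  pmCount U k (suc r) = ΣΣ (λ i j → if nextEntryOk k i j then pmCount (U ∪ i) (suc j) r else 0)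

  countL-pmTail≡pmCount : (U : RowSet) (k s r : ℕ) → countL (λ v → pmTail U k (label s v)) (allVecs positions r) ≡ pmCount U k r
  countL-pmTail≡pmCount U k s zero    = +-identityʳ _
  countL-pmTail≡pmCount U k s (suc r) = begin
      countL (λ v → pmTail U k (label s v)) (allVecs positions (suc r))
    ≡⟨ countL-allVecs-∷ positions r _ _ (pmTail-label-∷ U k s) ⟩
      sum (map (λ x → let i = toℕ (proj₁ x) ; j = toℕ (proj₂ x) in if nextEntryOk k i j then count i j else 0) positions)
    ≡⟨ sum-positions (λ i j → if nextEntryOk k i j then count i j else 0) ⟩
      ΣΣ (λ i j → if nextEntryOk k i j then count i j else 0)
    ≡⟨ ΣΣ-cong (λ i j _ _ → cong (if nextEntryOk k i j then_else 0) (countL-pmTail≡pmCount (U ∪ i) (suc j) (suc s) r)) ⟩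
      pmCount U k (suc r)
    ∎
    where
    open ≡-Reasoning
    count : ℕ → ℕ → ℕ
    count i j = countL (λ v → pmTail (U ∪ i) (suc j) (label (suc s) v)) (allVecs positions r)

  pmCount-vanish : (U : RowSet) (k r : ℕ) → r + k < N → pmCount U k r ≡ 0
  pmCount-vanish U k zero    r+k<N with pmTail U k [] in eq
  ... | false = refl
  ... | true  = ⊥-elim (<⇒≱ r+k<N (pmTail-[]⇒N≤k U k (≡true⇒T eq)))
  pmCount-vanish U k (suc r) r+k<N = ΣΣ-zero term
    where
    term : ∀ i j → i < N → j < N → (if nextEntryOk k i j then pmCount (U ∪ i) (suc j) r else 0) ≡ 0
    term i j _ _ with nextEntryOk k i j in ok
    ... | false = refl
    ... | true  with nextEntryOk⁻ k i j (≡true⇒T ok)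
    ...   | _ , _ , j≤k =
      pmCount-vanish (U ∪ i) (suc j) r (≤-<-trans (≤-reflexive (+-suc r j)) (≤-<-trans (s≤s (+-monoʳ-≤ r j≤k)) r+k<N))

-- The weight of an entry of the partition matrix is fixed once the next entry is placed:
-- t² if the next entry lies in the same column, t + t² if it starts a new column.
weighPrevious : Bool → Laurent → Laurent
weighPrevious true  f e = f (e ℤ.+ -[1+ 1 ])
weighPrevious false f e = f (e ℤ.+ -[1+ 0 ]) + f (e ℤ.+ -[1+ 1 ])

weighPrevious-vanish : (b : Bool) (f : Laurent) (r : ℕ) (e : ℤ) → (∀ e′ → e′ ℤ.≤ + r → f e′ ≡ 0) →
  e ℤ.≤ + suc r → weighPrevious b f e ≡ 0
weighPrevious-vanish true  f r e f-vanish e≤ = f-vanish _ (ℤ.≤-trans e-2≤e-1 (ℤ.+-monoˡ-≤ -[1+ 0 ] e≤))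
  where e-2≤e-1 = ℤ.+-monoʳ-≤ e (ℤ.-≤- z≤n)
weighPrevious-vanish false f r e f-vanish e≤ =
  cong₂ _+_ (f-vanish _ (ℤ.+-monoˡ-≤ -[1+ 0 ] e≤)) (weighPrevious-vanish true f r e f-vanish e≤)

binomT-suc : (n : ℕ) (x e : ℤ) →
  binomT (suc n) (x ℤ.+ + 1 ℤ.+ + 1) e ≡ binomT n x (e ℤ.+ -[1+ 1 ]) + binomT n x (e ℤ.+ -[1+ 0 ])
binomT-suc n x e = cong₂ _+_ (binomT-shift₂ n x e)
  (trans (binomT-shift₂ n x (e ℤ.+ + 1)) (cong (binomT n x) (ℤ.+-assoc e (+ 1) -[1+ 1 ])))

tPow-below : {x e : ℤ} → e ℤ.< x → tPow x e ≡ 0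
tPow-below {x} {e} e<x = cong (if_then 1 else 0) (dec-false (e ℤ.≟ x) (ℤ.<⇒≢ e<x))

module PMPoly (N : ℕ) where
  open PMCount N public

  pmPoly : RowSet → ℕ → ℕ → Laurent
  pmPoly U k zero    e = if pmTail U k [] then binomT 1 (+ 2) e else 0
  pmPoly U k (suc r) e = ΣΣ (λ i j → if nextEntryOk k i j then weighPrevious (suc j ≡ᵇ k) (pmPoly (U ∪ i) (suc j) r) e else 0)

  pmPoly-resp-≐ : {U U′ : RowSet} (k r : ℕ) → U ≐ U′ → ∀ e → pmPoly U k r e ≡ pmPoly U′ k r e
  pmPoly-resp-≐ k zero    U≐U′ e = cong (if_then binomT 1 (+ 2) e else 0) (pmTail-resp-≐ k [] U≐U′)
  pmPoly-resp-≐ k (suc r) U≐U′ e = ΣΣ-cong (λ i j _ _ → cong (if nextEntryOk k i j then_else 0)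
    (weighPrevious-cong (suc j ≡ᵇ k) (pmPoly-resp-≐ (suc j) r (∪-resp-≐ i U≐U′)) e))
    where
    weighPrevious-cong : (b : Bool) {f g : Laurent} → (∀ e → f e ≡ g e) → ∀ e → weighPrevious b f e ≡ weighPrevious b g e
    weighPrevious-cong true  f≗g e = f≗g _
    weighPrevious-cong false f≗g e = cong₂ _+_ (f≗g _) (f≗g _)

  pmPoly-vanish : (U : RowSet) (k r : ℕ) (e : ℤ) → e ℤ.≤ + r → pmPoly U k r e ≡ 0
  pmPoly-vanish U k zero e e≤0 with pmTail U k []
  ... | false = refl
  ... | true  = cong₂ _+_ (tPow-below (ℤ.≤-<-trans e≤0 (ℤ.+<+ (s≤s z≤n))))
                          (tPow-below (ℤ.≤-<-trans (ℤ.+-monoˡ-≤ (+ 1) e≤0) (ℤ.+<+ (s≤s (s≤s z≤n)))))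
  pmPoly-vanish U k (suc r) e e≤ = ΣΣ-zero term
    where
    term : ∀ i j → i < N → j < N → (if nextEntryOk k i j then weighPrevious (suc j ≡ᵇ k) (pmPoly (U ∪ i) (suc j) r) e else 0) ≡ 0
    term i j _ _ with nextEntryOk k i j
    ... | false = refl
    ... | true  = weighPrevious-vanish (suc j ≡ᵇ k) _ r e (pmPoly-vanish (U ∪ i) (suc j) r) e≤

  pmPoly≡pmCount*binomT : (U : RowSet) (k r : ℕ) (e : ℤ) → pmPoly U k r e ≡ pmCount U k r * binomT (suc (N ∸ k)) (twice-suc r) e
  pmPoly≡pmCount*binomT U k zero e with pmTail U k [] in eq
  ... | false = refl
  ... | true rewrite m≤n⇒m∸n≡0 (pmTail-[]⇒N≤k U k (≡true⇒T eq)) = sym (+-identityʳ _)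
  pmPoly≡pmCount*binomT U k (suc r) e = trans (ΣΣ-cong term) (ΣΣ-*ʳ _ _)
    where
    sameColumn : ∀ i j → weighPrevious true (pmPoly (U ∪ i) (suc j) r) e
                          ≡ pmCount (U ∪ i) (suc j) r * binomT (suc (N ∸ suc j)) (twice-suc (suc r)) e
    sameColumn i j = trans (pmPoly≡pmCount*binomT (U ∪ i) (suc j) r _)
      (cong (pmCount (U ∪ i) (suc j) r *_) (sym (binomT-shift₂ (suc (N ∸ suc j)) (twice-suc r) e)))

    newColumn : ∀ i j → j < N → weighPrevious false (pmPoly (U ∪ i) (suc j) r) e
                                 ≡ pmCount (U ∪ i) (suc j) r * binomT (suc (N ∸ j)) (twice-suc (suc r)) e
    newColumn i j j<N = begin
        pmPoly (U ∪ i) (suc j) r (e ℤ.+ -[1+ 0 ]) + pmPoly (U ∪ i) (suc j) r (e ℤ.+ -[1+ 1 ])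
      ≡⟨ cong₂ _+_ (pmPoly≡pmCount*binomT (U ∪ i) (suc j) r _) (pmPoly≡pmCount*binomT (U ∪ i) (suc j) r _) ⟩
        F * B (e ℤ.+ -[1+ 0 ]) + F * B (e ℤ.+ -[1+ 1 ])
      ≡⟨ trans (+-comm (F * B _) _) (sym (*-distribˡ-+ F _ _)) ⟩
        F * (B (e ℤ.+ -[1+ 1 ]) + B (e ℤ.+ -[1+ 0 ]))
      ≡⟨ cong (F *_) (sym (binomT-suc (suc (N ∸ suc j)) (twice-suc r) e)) ⟩
        F * binomT (suc (suc (N ∸ suc j))) (twice-suc (suc r)) e
      ≡⟨ cong (λ n → F * binomT (suc n) (twice-suc (suc r)) e) (sym (∸-suc-pred N j j<N)) ⟩
        F * binomT (suc (N ∸ j)) (twice-suc (suc r)) e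
      ∎
      where
      open ≡-Reasoning
      F = pmCount (U ∪ i) (suc j) r
      B = binomT (suc (N ∸ suc j)) (twice-suc r)

    term : ∀ i j → i < N → j < N →
      (if nextEntryOk k i j then weighPrevious (suc j ≡ᵇ k) (pmPoly (U ∪ i) (suc j) r) e else 0)
        ≡ (if nextEntryOk k i j then pmCount (U ∪ i) (suc j) r else 0) * binomT (suc (N ∸ k)) (twice-suc (suc r)) e
    term i j _ j<N with nextEntryOk k i j in ok
    ... | false = refl
    ... | true with nextEntryOk⁻ k i j (≡true⇒T ok) | suc j ≟ k
    ...   | _ | yes refl rewrite ≡ᵇ-refl (suc j) = sameColumn i j
    ...   | _ , k∸1≤j , j≤k | no 1+j≢k rewrite ≢⇒≡ᵇ-false 1+j≢k =
      trans (newColumn i j j<N) (cong (λ m → pmCount (U ∪ i) (suc j) r * binomT (suc (N ∸ m)) (twice-suc (suc r)) e) j≡k)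
      where
      j≡k : j ≡ k
      j≡k = ≤-antisym j≤k (≤-pred (≤∧≢⇒< (≤-trans (m≤n+m∸n k 1) (s≤s k∸1≤j)) (1+j≢k ∘ sym)))

-- Tails of IPPMs

isOdd : ℕ → Bool
isOdd zero    = false
isOdd (suc n) = not (isOdd n)

isOdd-+1 : (n : ℕ) → isOdd (n + 1) ≡ not (isOdd n)
isOdd-+1 n rewrite +-comm n 1 = refl

%2≡isOdd : (n : ℕ) → n % 2 ≡ (if isOdd n then 1 else 0)
%2≡isOdd zero          = refl
%2≡isOdd (suc zero)    = refl
%2≡isOdd (suc (suc n)) rewrite not-involutive (isOdd n) = %2≡isOdd n

%2-suc : (m n : ℕ) → (suc m % 2 ≡ᵇ n % 2) ≡ not (m % 2 ≡ᵇ n % 2)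
%2-suc m n rewrite %2≡isOdd (suc m) | %2≡isOdd m | %2≡isOdd n with isOdd m | isOdd n
... | true  | true  = refl
... | true  | false = refl
... | false | true  = refl
... | false | false = refl

⌈+1/2⌉ : (n : ℕ) → ⌈ n + 1 /2⌉ ≡ ⌈ n /2⌉ + (if isOdd n then 0 else 1)
⌈+1/2⌉ zero          = refl
⌈+1/2⌉ (suc zero)    = refl
⌈+1/2⌉ (suc (suc n)) rewrite ⌈+1/2⌉ n | not-involutive (isOdd n) = refl

⊓'-left : (t m : ℕ) → m ≡ 0 ⊎ suc t < m → suc t ⊓' m ≡ suc t
⊓'-left t zero    _                 = refl
⊓'-left t (suc m) (inj₂ (s≤s t<m)) = cong suc (m≤n⇒m⊓n≡m (<⇒≤ t<m))

minInCol-label : {D n : ℕ} (t : ℕ) (v : Vec (Fin D × Fin D) n) (c : ℕ) →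
  minInCol (label t v) c ≡ 0 ⊎ t ≤ minInCol (label t v) c
minInCol-label t [] c = inj₁ refl
minInCol-label t ((_ , c′) ∷ v) c with toℕ c′ ≡ᵇ c | minInCol-label (suc t) v c
... | false | inj₁ none  = inj₁ none
... | false | inj₂ t<   = inj₂ (<⇒≤ t<)
... | true  | bound with t
...   | zero   = inj₂ z≤n
...   | suc t′ = inj₂ (≤-reflexive (sym (⊓'-left t′ _ bound)))

tally : (ℕ → ℕ) → ℕ → (ℕ → ℕ)
tally K c d = K d + (if c ≡ᵇ d then 1 else 0)

-- properDA, with the least element of the column of e supplied as μ.
properStep : ℕ → Entry → Entry → Bool
properStep μ e e′ = (1 <ᵇ eltOf e) ∧ (colOf e ≡ᵇ colOf e′) ∧ not (rowOf e ≡ᵇ rowOf e′) ∧ (eltOf e % 2 ≡ᵇ μ % 2)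

improperFrom : ℕ → Entry → List Entry → Bool
improperFrom μ prev []       = true
improperFrom μ prev (e ∷ es) = not (properStep μ prev e) ∧ improperFrom (if colOf e ≡ᵇ colOf prev then μ else eltOf e) e es

module IPPMTail (N : ℕ) where
  open PMPoly N public

  semiWeightIs : (ℕ → ℕ) → ℕ → List Entry → Bool
  semiWeightIs K a es = Σ< N (λ d → ⌈ K d + colSize es d /2⌉) ≡ᵇ a

  -- An IPPM tail of semi-weight a after a prefix with column counts K, whose
  -- last entry prev lies in a column with least element μ.
  ippmTail : RowSet → ℕ → Entry → ℕ → (ℕ → ℕ) → ℕ → List Entry → Bool
  ippmTail U k prev μ K a es = (pmTail U k es ∧ improperFrom μ prev es) ∧ semiWeightIs K a es

  semiWeightIs-∷ : (K : ℕ → ℕ) (a : ℕ) (e : Entry) (es : List Entry) →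
    semiWeightIs K a (e ∷ es) ≡ semiWeightIs (tally K (colOf e)) a es
  semiWeightIs-∷ K a e es = cong (_≡ᵇ a) (sum-map-cong (upTo N)
    (λ d → cong ⌈_/2⌉ (sym (+-assoc (K d) (if colOf e ≡ᵇ d then 1 else 0) (colSize es d)))))

  ippmTail-label-∷ : (U : RowSet) (k : ℕ) (prev : Entry) (μ : ℕ) (K : ℕ → ℕ) (a s : ℕ) {n : ℕ}
    (x : Fin N × Fin N) (v : Vec (Fin N × Fin N) n) →
    let i = toℕ (proj₁ x) ; j = toℕ (proj₂ x) in
    ippmTail U k prev μ K a (label s (x ∷ v)) ≡
      (nextEntryOk k i j ∧ not (properStep μ prev (s , i , j))) ∧
      ippmTail (U ∪ i) (suc j) (s , i , j) (if j ≡ᵇ colOf prev then μ else s) (tally K j) a (label (suc s) v)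
  ippmTail-label-∷ U k prev μ K a s (r , c) v =
    trans (cong₂ (λ p w → (p ∧ improperFrom μ prev (label s ((r , c) ∷ v))) ∧ w)
                 (pmTail-label-∷ U k s (r , c) v) (semiWeightIs-∷ K a e rest))
      (shuffle (nextEntryOk k (toℕ r) (toℕ c)) (pmTail (U ∪ toℕ r) (suc (toℕ c)) rest) (not (properStep μ prev e))
               (improperFrom (if toℕ c ≡ᵇ colOf prev then μ else s) e rest) (semiWeightIs (tally K (toℕ c)) a rest))
    where
    open ∨-∧-Solver using (solve; _:*_; _:=_)
    e = (s , toℕ r , toℕ c)
    rest = label (suc s) v
    shuffle : ∀ o p n i w → ((o ∧ p) ∧ (n ∧ i)) ∧ w ≡ (o ∧ n) ∧ ((p ∧ i) ∧ w)
    shuffle = solve 5 (λ o p n i w → ((o :* p) :* (n :* i)) :* w := (o :* n) :* ((p :* i) :* w)) refl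

  -- F is the whole matrix, from which properDA reads the column minima; improperFrom
  -- tracks them along the way instead.
  allImproper≡improperFrom : (F : List Entry) (s′ r₀ c₀ μ : ℕ) (U : RowSet) {n : ℕ} (v : Vec (Fin N × Fin N) n) →
    minInCol F c₀ ≡ μ →
    (∀ d → c₀ < d → minInCol F d ≡ minInCol (label (suc s′) v) d) →
    T (pmTail U (suc c₀) (label (suc s′) v)) →
    all (λ q → not (properDA F q)) (consecutive ((s′ , r₀ , c₀) ∷ label (suc s′) v))
      ≡ improperFrom μ (s′ , r₀ , c₀) (label (suc s′) v)
  allImproper≡improperFrom F s′ r₀ c₀ μ U [] _ _ _ = refl
  allImproper≡improperFrom F s′ r₀ c₀ μ U ((r , c) ∷ v) min-c₀ min-later tail =
    cong₂ _∧_ (cong (λ z → not ((1 <ᵇ s′) ∧ (c₀ ≡ᵇ toℕ c) ∧ not (r₀ ≡ᵇ toℕ r) ∧ (s′ % 2 ≡ᵇ z % 2))) min-c₀)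
      (allImproper≡improperFrom F (suc s′) (toℕ r) (toℕ c) μ′ (U ∪ toℕ r) v min-c min-later′ (proj₂ tail′))
    where
    rest = label (suc (suc s′)) v
    μ′ = if toℕ c ≡ᵇ c₀ then μ else suc s′
    tail′ = T-∧⁻ (subst T (pmTail-label-∷ U (suc c₀) (suc s′) (r , c) v) tail)
    c₀≤c : c₀ ≤ toℕ c
    c₀≤c = proj₁ (proj₂ (nextEntryOk⁻ (suc c₀) (toℕ r) (toℕ c) (proj₁ tail′)))
    min-c : minInCol F (toℕ c) ≡ μ′
    min-c with toℕ c ≟ c₀
    ... | yes refl rewrite ≡ᵇ-refl (toℕ c) = min-c₀
    ... | no c≢c₀ rewrite ≢⇒≡ᵇ-false c≢c₀ = begin
        minInCol F (toℕ c)
      ≡⟨ min-later (toℕ c) (≤∧≢⇒< c₀≤c (c≢c₀ ∘ sym)) ⟩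
        (if toℕ c ≡ᵇ toℕ c then suc s′ ⊓' minInCol rest (toℕ c) else minInCol rest (toℕ c))
      ≡⟨ cong (if_then suc s′ ⊓' minInCol rest (toℕ c) else minInCol rest (toℕ c)) (≡ᵇ-refl (toℕ c)) ⟩
        suc s′ ⊓' minInCol rest (toℕ c)
      ≡⟨ ⊓'-left s′ _ (minInCol-label (suc (suc s′)) v (toℕ c)) ⟩
        suc s′
      ∎
      where open ≡-Reasoning
    min-later′ : ∀ d → toℕ c < d → minInCol F d ≡ minInCol rest d
    min-later′ d c<d = trans (min-later d (≤-<-trans c₀≤c c<d))
      (cong (if_then suc s′ ⊓' minInCol rest d else minInCol rest d) (≢⇒≡ᵇ-false (<⇒≢ c<d)))

  noCounts : ℕ → ℕ
  noCounts _ = 0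

  isIPPM-∷ : (a : ℕ) {n : ℕ} (x : Fin N × Fin N) (v : Vec (Fin N × Fin N) n) →
    let i = toℕ (proj₁ x) ; j = toℕ (proj₂ x) in
    (isIPPM (N , x ∷ v) ∧ (semiWeight (N , x ∷ v) ≡ᵇ a)) ≡
      nextEntryOk 0 i j ∧ ippmTail (∅ ∪ i) (suc j) (1 , i , j) 1 (tally noCounts j) a (label 2 v)
  isIPPM-∷ a (r , c) v = begin
      (isPM (N , (r , c) ∷ v) ∧ allImproper (N , (r , c) ∷ v)) ∧ semiWeightIs noCounts a F
    ≡⟨ cong (λ p → (p ∧ allImproper (N , (r , c) ∷ v)) ∧ semiWeightIs noCounts a F) (isPM≡pmTail ((r , c) ∷ v)) ⟩
      (pmTail ∅ 0 F ∧ allImproper (N , (r , c) ∷ v)) ∧ semiWeightIs noCounts a F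
    ≡⟨ cong (_∧ semiWeightIs noCounts a F) (∧-congˡ-T improper) ⟩
      (pmTail ∅ 0 F ∧ improperFrom 1 e₀ rest) ∧ semiWeightIs noCounts a F
    ≡⟨ cong₂ (λ p w → (p ∧ improperFrom 1 e₀ rest) ∧ w)
             (pmTail-label-∷ ∅ 0 1 (r , c) v) (semiWeightIs-∷ noCounts a e₀ rest) ⟩
      ((ok ∧ pmTail (∅ ∪ i) (suc j) rest) ∧ improperFrom 1 e₀ rest) ∧ semiWeightIs (tally noCounts j) a rest
    ≡⟨ solve 4 (λ o p i w → ((o :* p) :* i) :* w := o :* ((p :* i) :* w)) refl ok _ _ _ ⟩
      ok ∧ ippmTail (∅ ∪ i) (suc j) e₀ 1 (tally noCounts j) a rest
    ∎
    where
    open ≡-Reasoning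
    open ∨-∧-Solver using (solve; _:*_; _:=_)
    i = toℕ r
    j = toℕ c
    ok = nextEntryOk 0 i j
    e₀ = (1 , i , j)
    rest = label 2 v
    F = e₀ ∷ rest
    improper : T (pmTail ∅ 0 F) → allImproper (N , (r , c) ∷ v) ≡ improperFrom 1 e₀ rest
    improper t = allImproper≡improperFrom F 1 i j 1 (∅ ∪ i) v min-j min-later
                   (proj₂ (T-∧⁻ {ok} (subst T (pmTail-label-∷ ∅ 0 1 (r , c) v) t)))
      where
      min-j : minInCol F j ≡ 1
      min-j rewrite ≡ᵇ-refl j = ⊓'-left 0 _ (minInCol-label 2 v j)
      min-later : ∀ d → j < d → minInCol F d ≡ minInCol rest d
      min-later d j<d = cong (if_then 1 ⊓' minInCol rest d else minInCol rest d) (≢⇒≡ᵇ-false (<⇒≢ j<d))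

-- Counting IPPMs

-- zShift S f a is the coefficient of z^a in z^S · Σ_r f r z^r.
zShift : ℕ → (ℕ → ℕ) → ℕ → ℕ
zShift S f a = if S ≤ᵇ a then f (a ∸ S) else 0

shiftDown : (ℕ → ℕ) → ℕ → ℕ
shiftDown f zero    = 0
shiftDown f (suc r) = f r

zShift-cong : (S : ℕ) {f g : ℕ → ℕ} (a : ℕ) → (∀ r → f r ≡ g r) → zShift S f a ≡ zShift S g a
zShift-cong S a f≗g = cong (if S ≤ᵇ a then_else 0) (f≗g (a ∸ S))

zShift-+ : (S : ℕ) (f : ℕ → ℕ) (n : ℕ) → zShift S f (S + n) ≡ f n
zShift-+ S f n rewrite T⇒≡true (≤⇒≤ᵇ (m≤m+n S n)) = cong f (m+n∸m≡n S n)

zShift-self : (S : ℕ) (f : ℕ → ℕ) → zShift S f S ≡ f 0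
zShift-self S f = trans (cong (zShift S f) (sym (+-identityʳ S))) (zShift-+ S f 0)

zShift-< : (S : ℕ) (f : ℕ → ℕ) {a : ℕ} → a < S → zShift S f a ≡ 0
zShift-< S f {a} a<S rewrite ¬T⇒≡false {S ≤ᵇ a} (<⇒≱ a<S ∘ ≤ᵇ⇒≤ S a) = refl

zShift-suc : (S : ℕ) (f : ℕ → ℕ) (a : ℕ) → zShift (suc S) f a ≡ zShift S (shiftDown f) a
zShift-suc S f a with compare S a
... | less .S r    = trans (zShift-+ (suc S) f r)
  (sym (trans (cong (zShift S (shiftDown f)) (sym (+-suc S r))) (zShift-+ S (shiftDown f) (suc r))))
... | equal .S     = trans (zShift-< (suc S) f (n<1+n S)) (sym (zShift-self S (shiftDown f)))
... | greater .a k = trans (zShift-< (suc S) f (m<n⇒m<1+n a<S)) (sym (zShift-< S (shiftDown f) a<S))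
  where a<S = s≤s (m≤m+n a k)

zShift-+-distrib : (S : ℕ) (f g : ℕ → ℕ) (a : ℕ) → zShift S f a + zShift S g a ≡ zShift S (λ r → f r + g r) a
zShift-+-distrib S f g a with S ≤ᵇ a
... | true  = refl
... | false = refl

zShift-indicator : (S : ℕ) (P : Bool) (a : ℕ) →
  zShift S (λ r → if P ∧ (r ≡ᵇ 0) then 1 else 0) a ≡ (if P ∧ (S ≡ᵇ a) then 1 else 0)
zShift-indicator S P a with compare S a
... | less .S r = begin
    zShift S g (suc (S + r))                    ≡⟨ cong (zShift S g) (sym (+-suc S r)) ⟩
    zShift S g (S + suc r)                      ≡⟨ zShift-+ S g (suc r) ⟩
    (if P ∧ false then 1 else 0)                ≡⟨ cong (λ b → if P ∧ b then 1 else 0) (sym (≢⇒≡ᵇ-false (m≢1+m+n S))) ⟩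
    (if P ∧ (S ≡ᵇ suc (S + r)) then 1 else 0)  ∎
  where
  open ≡-Reasoning
  g = λ r → if P ∧ (r ≡ᵇ 0) then 1 else 0
... | equal .S rewrite ≡ᵇ-refl S = zShift-self S (λ r → if P ∧ (r ≡ᵇ 0) then 1 else 0)
... | greater .a k rewrite ≢⇒≡ᵇ-false (m≢1+m+n a {k} ∘ sym) =
  trans (zShift-< (suc (a + k)) (λ r → if P ∧ (r ≡ᵇ 0) then 1 else 0) (s≤s (m≤m+n a k))) (sym (cong (if_then 1 else 0) (∧-zeroʳ P)))

module _ (μ s′ r₀ c i j : ℕ) where

  properStep-new-column : c ≢ j → properStep μ (s′ , r₀ , c) (suc s′ , i , j) ≡ false
  properStep-new-column c≢j rewrite ≢⇒≡ᵇ-false c≢j = ∧-zeroʳ (1 <ᵇ s′)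

  properStep-same-row : i ≡ r₀ → properStep μ (s′ , r₀ , c) (suc s′ , i , j) ≡ false
  properStep-same-row refl rewrite ≡ᵇ-refl i = trans (cong ((1 <ᵇ s′) ∧_) (∧-zeroʳ (c ≡ᵇ j))) (∧-zeroʳ (1 <ᵇ s′))

  properStep-closed : (s′ % 2 ≡ᵇ μ % 2) ≡ false → properStep μ (s′ , r₀ , c) (suc s′ , i , j) ≡ false
  properStep-closed closed rewrite closed | ∧-zeroʳ (not (r₀ ≡ᵇ i)) | ∧-zeroʳ (c ≡ᵇ j) = ∧-zeroʳ (1 <ᵇ s′)

properStep-descent : (μ s′ r₀ c i : ℕ) → 1 < s′ → i ≢ r₀ → (s′ % 2 ≡ᵇ μ % 2) ≡ true →
  properStep μ (s′ , r₀ , c) (suc s′ , i , c) ≡ true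
properStep-descent μ s′ r₀ c i 1<s′ i≢r₀ open′
  rewrite open′ | <⇒<ᵇ-true 1<s′ | ≡ᵇ-refl c | ≢⇒≡ᵇ-false (i≢r₀ ∘ sym) = refl

module IPPMCount (N : ℕ) where
  open IPPMTail N public

  semiW : (ℕ → ℕ) → ℕ
  semiW K = Σ< N (λ d → ⌈ K d /2⌉)

  semiW-tally : (K : ℕ → ℕ) (c : ℕ) → c < N → semiW (tally K c) ≡ semiW K + (if isOdd (K c) then 0 else 1)
  semiW-tally K c c<N = Σ<-update N c _ c<N
    (λ d _ d≢c → cong ⌈_/2⌉ (trans (cong (_+_ (K d)) (cong (if_then 1 else 0) (≢⇒≡ᵇ-false (d≢c ∘ sym)))) (+-identityʳ (K d))))
    (trans (cong (λ b → ⌈ K c + (if b then 1 else 0) /2⌉) (≡ᵇ-refl c)) (⌈+1/2⌉ (K c)))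

  isOdd-tally : (K : ℕ → ℕ) (c : ℕ) → isOdd (tally K c c) ≡ not (isOdd (K c))
  isOdd-tally K c = trans (cong (λ b → isOdd (K c + (if b then 1 else 0))) (≡ᵇ-refl c)) (isOdd-+1 (K c))

  ippmCount : RowSet → ℕ → Entry → ℕ → (ℕ → ℕ) → ℕ → ℕ → ℕ → ℕ
  ippmCount U k prev μ K a s r = countL (λ v → ippmTail U k prev μ K a (label s v)) (allVecs positions r)

  ippmCount-zero : (U : RowSet) (k : ℕ) (prev : Entry) (μ : ℕ) (K : ℕ → ℕ) (a s : ℕ) →
    ippmCount U k prev μ K a s 0 ≡ (if pmTail U k [] ∧ (semiW K ≡ᵇ a) then 1 else 0)
  ippmCount-zero U k prev μ K a s = trans (+-identityʳ _)
    (cong (if_then 1 else 0) (cong₂ _∧_ (∧-identityʳ (pmTail U k []))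
       (cong (_≡ᵇ a) (sum-map-cong (upTo N) (λ d → cong ⌈_/2⌉ (+-identityʳ (K d)))))))

  ippmCount-suc : (U : RowSet) (k : ℕ) (prev : Entry) (μ : ℕ) (K : ℕ → ℕ) (a s r : ℕ) →
    ippmCount U k prev μ K a s (suc r) ≡ ΣΣ (λ i j → if nextEntryOk k i j ∧ not (properStep μ prev (s , i , j))
      then ippmCount (U ∪ i) (suc j) (s , i , j) (if j ≡ᵇ colOf prev then μ else s) (tally K j) a (suc s) r else 0)
  ippmCount-suc U k prev μ K a s r =
    trans (countL-allVecs-∷ positions r _ _ (ippmTail-label-∷ U k prev μ K a s)) (sum-positions _)

  -- pmPoly U k r counts the current entry with weight t² or t + t²;
  -- pmPoly₀ U k r counts it with weight 1.
  pmPoly₀ : RowSet → ℕ → ℕ → Laurent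
  pmPoly₀ U k zero    e = if pmTail U k [] then tPow (+ 0) e else 0
  pmPoly₀ U k (suc r) e = ΣΣ (λ i j → if nextEntryOk k i j then pmPoly (U ∪ i) (suc j) r e else 0)

  pmPoly₀-resp-≐ : {U U′ : RowSet} (k r : ℕ) → U ≐ U′ → ∀ e → pmPoly₀ U k r e ≡ pmPoly₀ U′ k r e
  pmPoly₀-resp-≐ k zero    U≐U′ e = cong (if_then tPow (+ 0) e else 0) (pmTail-resp-≐ k [] U≐U′)
  pmPoly₀-resp-≐ k (suc r) U≐U′ e = ΣΣ-cong (λ i j _ _ → cong (if nextEntryOk k i j then_else 0)
    (pmPoly-resp-≐ (suc j) r (∪-resp-≐ i U≐U′) e))

  -- t² · pmPoly₀ plus t times the completions whose next entry opens a new column.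
  pmPoly-split : (U : RowSet) (k r m : ℕ) → pmPoly U k r (+ suc (suc m)) ≡ pmPoly₀ U k r (+ m) +
    ΣΣ (λ i j → if nextEntryOk k i j ∧ not (suc j ≡ᵇ k) then shiftDown (λ r′ → pmPoly (U ∪ i) (suc j) r′ (+ suc m)) r else 0)
  pmPoly-split U k zero m = trans
    (cong (if pmTail U k [] then_else 0) (trans (cong (_+_ (tPow (+ 2) (+ suc (suc m)))) t²-above) (+-identityʳ _)))
    (sym (trans (cong (_+_ (pmPoly₀ U k zero (+ m))) (ΣΣ-zero (λ i j _ _ → if-same _ 0))) (+-identityʳ _)))
    where
    t²-above : tPow (+ 2) (+ suc (suc m) ℤ.+ + 1) ≡ 0
    t²-above rewrite +-comm m 1 = refl
  pmPoly-split U k (suc r) m = trans (ΣΣ-cong term) (ΣΣ-+ _ _)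
    where
    term : ∀ i j → i < N → j < N →
      (if nextEntryOk k i j then weighPrevious (suc j ≡ᵇ k) (pmPoly (U ∪ i) (suc j) r) (+ suc (suc m)) else 0) ≡
        (if nextEntryOk k i j then pmPoly (U ∪ i) (suc j) r (+ m) else 0) +
        (if nextEntryOk k i j ∧ not (suc j ≡ᵇ k) then pmPoly (U ∪ i) (suc j) r (+ suc m) else 0)
    term i j _ _ with nextEntryOk k i j
    ... | false = refl
    ... | true with suc j ≡ᵇ k
    ...   | true  = sym (+-identityʳ _)
    ...   | false = +-comm (pmPoly (U ∪ i) (suc j) r (+ suc m)) _

  pmPoly₀-shiftDown : (U : RowSet) (k r m : ℕ) → pmPoly₀ U k r (+ suc m) ≡
    ΣΣ (λ i j → if nextEntryOk k i j then shiftDown (λ r′ → pmPoly (U ∪ i) (suc j) r′ (+ suc m)) r else 0)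
  pmPoly₀-shiftDown U k zero    m = trans (if-same (pmTail U k []) 0) (sym (ΣΣ-zero (λ i j _ _ → if-same _ 0)))
  pmPoly₀-shiftDown U k (suc r) m = refl

  zShift-ΣΣ : (S a : ℕ) (b : ℕ → ℕ → Bool) (h : ℕ → ℕ → ℕ → ℕ) →
    ΣΣ (λ i j → if b i j then zShift S (h i j) a else 0) ≡ zShift S (λ r → ΣΣ (λ i j → if b i j then h i j r else 0)) a
  zShift-ΣΣ S a b h with S ≤ᵇ a
  ... | true  = refl
  ... | false = ΣΣ-zero (λ i j _ _ → if-same (b i j) 0)

  -- An open pair already has its first entry placed, hence the exponent m + 1.
  tailPoly : Bool → RowSet → ℕ → ℕ → ℕ → ℕ
  tailPoly true  U k m r = pmPoly U k r (+ suc m)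
  tailPoly false U k m r = pmPoly₀ U k r (+ m)

  tailPoly-resp-≐ : (b : Bool) {U U′ : RowSet} (k m : ℕ) → U ≐ U′ → ∀ r → tailPoly b U k m r ≡ tailPoly b U′ k m r
  tailPoly-resp-≐ true  k m U≐U′ r = pmPoly-resp-≐ k r U≐U′ _
  tailPoly-resp-≐ false k m U≐U′ r = pmPoly₀-resp-≐ k r U≐U′ _

  tailPoly-zero : (b : Bool) (U : RowSet) (k r : ℕ) → tailPoly b U k 0 r ≡ (if pmTail U k [] ∧ (r ≡ᵇ 0) then 1 else 0)
  tailPoly-zero true U k zero with pmTail U k []
  ... | true  = refl
  ... | false = refl
  tailPoly-zero true U k (suc r) = trans (pmPoly-vanish U k (suc r) (+ 1) (ℤ.+≤+ (s≤s z≤n)))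
    (sym (cong (if_then 1 else 0) (∧-zeroʳ (pmTail U k []))))
  tailPoly-zero false U k zero with pmTail U k []
  ... | true  = refl
  ... | false = refl
  tailPoly-zero false U k (suc r) = trans (ΣΣ-zero term) (sym (cong (if_then 1 else 0) (∧-zeroʳ (pmTail U k []))))
    where
    term : ∀ i j → i < N → j < N → (if nextEntryOk k i j then pmPoly (U ∪ i) (suc j) r (+ 0) else 0) ≡ 0
    term i j _ _ with nextEntryOk k i j
    ... | false = refl
    ... | true  = pmPoly-vanish (U ∪ i) (suc j) r (+ 0) (ℤ.+≤+ z≤n)

  expected : RowSet → ℕ → (ℕ → ℕ) → ℕ → ℕ → ℕ
  expected U c K a m = zShift (semiW K) (tailPoly (isOdd (K c)) U (suc c) m) a

  expected-after-odd : (U : RowSet) (K : ℕ → ℕ) (c a m : ℕ) → c < N → isOdd (K c) ≡ true →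
    expected U c (tally K c) a m ≡ zShift (semiW K) (tailPoly false U (suc c) m) a
  expected-after-odd U K c a m c<N odd rewrite isOdd-tally K c | odd | semiW-tally K c c<N | odd =
    cong (λ S → zShift S (tailPoly false U (suc c) m) a) (+-identityʳ (semiW K))

  expected-after-even : (U : RowSet) (K : ℕ → ℕ) (c a m : ℕ) → c < N → isOdd (K c) ≡ false →
    expected U c (tally K c) a m ≡ zShift (suc (semiW K)) (tailPoly true U (suc c) m) a
  expected-after-even U K c a m c<N even rewrite isOdd-tally K c | even | semiW-tally K c c<N | even =
    cong (λ S → zShift S (tailPoly true U (suc c) m) a) (+-comm (semiW K) 1)

  zShift-tailPoly-open : (U : RowSet) (k m S a : ℕ) →
    zShift S (tailPoly false U k m) a +
    ΣΣ (λ i j → if nextEntryOk k i j ∧ not (suc j ≡ᵇ k) then zShift (suc S) (tailPoly true (U ∪ i) (suc j) m) a else 0)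
      ≡ zShift S (tailPoly true U k (suc m)) a
  zShift-tailPoly-open U k m S a = begin
      zShift S (tailPoly false U k m) a + ΣΣ (λ i j → if new i j then zShift (suc S) (h i j) a else 0)
    ≡⟨ cong (_+_ (zShift S (tailPoly false U k m) a)) (ΣΣ-cong (λ i j _ _ → cong (if new i j then_else 0) (zShift-suc S (h i j) a))) ⟩
      zShift S (tailPoly false U k m) a + ΣΣ (λ i j → if new i j then zShift S (shiftDown (h i j)) a else 0)
    ≡⟨ cong (_+_ (zShift S (tailPoly false U k m) a)) (zShift-ΣΣ S a new (λ i j → shiftDown (h i j))) ⟩
      zShift S (tailPoly false U k m) a + zShift S (λ r → ΣΣ (λ i j → if new i j then shiftDown (h i j) r else 0)) a
    ≡⟨ zShift-+-distrib S (tailPoly false U k m) (λ r → ΣΣ (λ i j → if new i j then shiftDown (h i j) r else 0)) a ⟩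
      zShift S (λ r → pmPoly₀ U k r (+ m) + ΣΣ (λ i j → if new i j then shiftDown (h i j) r else 0)) a
    ≡⟨ zShift-cong S a (λ r → sym (pmPoly-split U k r m)) ⟩
      zShift S (tailPoly true U k (suc m)) a
    ∎
    where
    open ≡-Reasoning
    new = λ i j → nextEntryOk k i j ∧ not (suc j ≡ᵇ k)
    h = λ i j → tailPoly true (U ∪ i) (suc j) m

  zShift-tailPoly-closed : (U : RowSet) (k m S a : ℕ) →
    ΣΣ (λ i j → if nextEntryOk k i j then zShift (suc S) (tailPoly true (U ∪ i) (suc j) m) a else 0)
      ≡ zShift S (tailPoly false U k (suc m)) a
  zShift-tailPoly-closed U k m S a = begin
      ΣΣ (λ i j → if nextEntryOk k i j then zShift (suc S) (h i j) a else 0)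
    ≡⟨ ΣΣ-cong (λ i j _ _ → cong (if nextEntryOk k i j then_else 0) (zShift-suc S (h i j) a)) ⟩
      ΣΣ (λ i j → if nextEntryOk k i j then zShift S (shiftDown (h i j)) a else 0)
    ≡⟨ zShift-ΣΣ S a (nextEntryOk k) (λ i j → shiftDown (h i j)) ⟩
      zShift S (λ r → ΣΣ (λ i j → if nextEntryOk k i j then shiftDown (h i j) r else 0)) a
    ≡⟨ zShift-cong S a (λ r → sym (pmPoly₀-shiftDown U k r m)) ⟩
      zShift S (tailPoly false U k (suc m)) a
    ∎
    where
    open ≡-Reasoning
    h = λ i j → tailPoly true (U ∪ i) (suc j) m

  -- The state after placing entry s′ at (r₀, c), where μ is the least element of column c.
  record Invariant (U : RowSet) (c s′ r₀ μ : ℕ) (K : ℕ → ℕ) : Set where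
    field
      c<N         : c < N
      r₀≤c        : r₀ ≤ c
      r₀-used     : U r₀ ≡ true
      later-empty : ∀ d → c < d → K d ≡ 0
      parity      : (s′ % 2 ≡ᵇ μ % 2) ≡ isOdd (K c)
      s′≥1        : 1 ≤ s′
      not-first   : 1 < s′ ⊎ c ≡ 0

  ClaimAt : ℕ → Set
  ClaimAt m = (U : RowSet) (c s′ r₀ μ : ℕ) (K : ℕ → ℕ) (a : ℕ) → Invariant U c s′ r₀ μ K →
    ippmCount U (suc c) (s′ , r₀ , c) μ K a (suc s′) m ≡ expected U c K a m

  claim-zero : ClaimAt 0
  claim-zero U c s′ r₀ μ K a _ = begin
      ippmCount U (suc c) (s′ , r₀ , c) μ K a (suc s′) 0
    ≡⟨ ippmCount-zero U (suc c) (s′ , r₀ , c) μ K a (suc s′) ⟩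
      (if pmTail U (suc c) [] ∧ (semiW K ≡ᵇ a) then 1 else 0)
    ≡⟨ sym (zShift-indicator (semiW K) (pmTail U (suc c) []) a) ⟩
      zShift (semiW K) (λ r → if pmTail U (suc c) [] ∧ (r ≡ᵇ 0) then 1 else 0) a
    ≡⟨ zShift-cong (semiW K) a (λ r → sym (tailPoly-zero (isOdd (K c)) U (suc c) r)) ⟩
      expected U c K a 0
    ∎
    where open ≡-Reasoning

  module ClaimStep (m : ℕ) (IH : ClaimAt m) (U : RowSet) (c s′ r₀ μ : ℕ) (K : ℕ → ℕ) (a : ℕ)
                   (inv : Invariant U c s′ r₀ μ K) where
    open Invariant inv

    μ′ : ℕ → ℕ
    μ′ j = if j ≡ᵇ c then μ else suc s′

    next term : ℕ → ℕ → ℕ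
    next i j = ippmCount (U ∪ i) (suc j) (suc s′ , i , j) (μ′ j) (tally K j) a (suc (suc s′)) m
    term i j = if nextEntryOk (suc c) i j ∧ not (properStep μ (s′ , r₀ , c) (suc s′ , i , j)) then next i j else 0

    allowed : ∀ i j → properStep μ (s′ , r₀ , c) (suc s′ , i , j) ≡ false →
      (if true ∧ not (properStep μ (s′ , r₀ , c) (suc s′ , i , j)) then next i j else 0) ≡ next i j
    allowed i j proper≡false = cong (λ b → if not b then next i j else 0) proper≡false

    next-invariant : ∀ i j → j < N → T (nextEntryOk (suc c) i j) → Invariant (U ∪ i) j (suc s′) i (μ′ j) (tally K j)
    next-invariant i j j<N ok = record
      { c<N = j<N ; r₀≤c = i≤j ; r₀-used = i-used ; later-empty = empty ; parity = parity′
      ; s′≥1 = s≤s z≤n ; not-first = inj₁ (s≤s s′≥1) }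
      where
      i≤j = proj₁ (nextEntryOk⁻ (suc c) i j ok)
      c≤j = proj₁ (proj₂ (nextEntryOk⁻ (suc c) i j ok))
      i-used : (U ∪ i) i ≡ true
      i-used rewrite ≡ᵇ-refl i = ∨-zeroʳ (U i)
      empty : ∀ d → j < d → tally K j d ≡ 0
      empty d j<d rewrite later-empty d (≤-<-trans c≤j j<d) | ≢⇒≡ᵇ-false (<⇒≢ j<d) = refl
      parity′ : (suc s′ % 2 ≡ᵇ μ′ j % 2) ≡ isOdd (tally K j j)
      parity′ with j ≟ c
      ... | yes refl rewrite ≡ᵇ-refl j = trans (%2-suc s′ μ) (trans (cong not parity) (sym (isOdd-+1 (K j))))
      ... | no j≢c rewrite ≢⇒≡ᵇ-false j≢c | ≡ᵇ-refl (suc s′ % 2) =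
        sym (trans (isOdd-tally K j) (cong (not ∘ isOdd) (later-empty j (≤∧≢⇒< c≤j (j≢c ∘ sym)))))

    IH′ : ∀ i j → j < N → T (nextEntryOk (suc c) i j) → next i j ≡ expected (U ∪ i) j (tally K j) a m
    IH′ i j j<N ok = IH (U ∪ i) j (suc s′) i (μ′ j) (tally K j) a (next-invariant i j j<N ok)

    stay : ℕ
    stay = zShift (semiW K) (tailPoly false U (suc c) m) a

    move : ℕ → ℕ → ℕ
    move i j = zShift (suc (semiW K)) (tailPoly true (U ∪ i) (suc j) m) a

    staying moving : ℕ → ℕ → ℕ
    staying i j = if (i ≡ᵇ r₀) ∧ (j ≡ᵇ c) then stay else 0
    moving  i j = if nextEntryOk (suc c) i j ∧ not (j ≡ᵇ c) then move i j else 0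

    move-to-new-column : ∀ i j → j < N → T (nextEntryOk (suc c) i j) → c ≤ j → j ≢ c →
      (if not (properStep μ (s′ , r₀ , c) (suc s′ , i , j)) then next i j else 0) ≡ move i j
    move-to-new-column i j j<N ok c≤j j≢c = begin
        (if not (properStep μ (s′ , r₀ , c) (suc s′ , i , j)) then next i j else 0)
      ≡⟨ allowed i j (properStep-new-column μ s′ r₀ c i j (j≢c ∘ sym)) ⟩
        next i j
      ≡⟨ IH′ i j j<N ok ⟩
        expected (U ∪ i) j (tally K j) a m
      ≡⟨ expected-after-even (U ∪ i) K j a m j<N (cong isOdd (later-empty j (≤∧≢⇒< c≤j (j≢c ∘ sym)))) ⟩
        move i j
      ∎
      where open ≡-Reasoning

    close-pair : isOdd (K c) ≡ true → T (nextEntryOk (suc c) r₀ c) →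
      (if not (properStep μ (s′ , r₀ , c) (suc s′ , r₀ , c)) then next r₀ c else 0) ≡ stay
    close-pair odd ok = begin
        (if not (properStep μ (s′ , r₀ , c) (suc s′ , r₀ , c)) then next r₀ c else 0)
      ≡⟨ allowed r₀ c (properStep-same-row μ s′ r₀ c r₀ c refl) ⟩
        next r₀ c
      ≡⟨ IH′ r₀ c c<N ok ⟩
        expected (U ∪ r₀) c (tally K c) a m
      ≡⟨ expected-after-odd (U ∪ r₀) K c a m c<N odd ⟩
        zShift (semiW K) (tailPoly false (U ∪ r₀) (suc c) m) a
      ≡⟨ zShift-cong (semiW K) a (tailPoly-resp-≐ false (suc c) m (∪-absorb r₀-used)) ⟩
        stay
      ∎
      where open ≡-Reasoning

    change-row : isOdd (K c) ≡ true → ∀ i → i ≤ c → i ≢ r₀ →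
      (if not (properStep μ (s′ , r₀ , c) (suc s′ , i , c)) then next i c else 0) ≡ 0
    change-row odd i i≤c i≢r₀ =
      cong (λ b → if not b then next i c else 0) (properStep-descent μ s′ r₀ c i 1<s′ i≢r₀ (trans parity odd))
      where
      1<s′ : 1 < s′
      1<s′ with not-first
      ... | inj₁ 1<s′ = 1<s′
      ... | inj₂ refl = ⊥-elim (i≢r₀ (trans (n≤0⇒n≡0 i≤c) (sym (n≤0⇒n≡0 r₀≤c))))

    -- While the pair of s′ is open, the next entry either closes it (same row and
    -- column), or starts a new column; a different row in column c would be a
    -- proper descent or ascent.
    term-open : isOdd (K c) ≡ true → ∀ i j → i < N → j < N → term i j ≡ staying i j + moving i j
    term-open odd i j _ j<N with nextEntryOk (suc c) i j in ok
    ... | false = sym (trans (+-identityʳ _) not-stay)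
      where
      not-stay : staying i j ≡ 0
      not-stay with i ≟ r₀ | j ≟ c
      ... | no i≢r₀  | _        rewrite ≢⇒≡ᵇ-false i≢r₀ = refl
      ... | yes _    | no j≢c   rewrite ≢⇒≡ᵇ-false j≢c | ∧-zeroʳ (i ≡ᵇ r₀) = refl
      ... | yes refl | yes refl = contradiction (trans (sym (nextEntryOk⁺ (suc c) r₀ c r₀≤c ≤-refl (n≤1+n c))) ok) λ ()
    ... | true with nextEntryOk⁻ (suc c) i j (≡true⇒T ok) | j ≟ c
    ...   | _ , c≤j , _ | no j≢c = trans (move-to-new-column i j j<N (≡true⇒T ok) c≤j j≢c)
      (sym (cong₂ (λ y x → (if y then stay else 0) + (if not x then move i j else 0))
                  (trans (cong ((i ≡ᵇ r₀) ∧_) (≢⇒≡ᵇ-false j≢c)) (∧-zeroʳ (i ≡ᵇ r₀))) (≢⇒≡ᵇ-false j≢c)))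
    ...   | i≤c , _ | yes refl with i ≟ r₀
    ...     | yes refl = trans (close-pair odd (≡true⇒T ok)) (sym (trans
      (cong₂ (λ y x → (if y then stay else 0) + (if not x then move r₀ c else 0)) (cong₂ _∧_ (≡ᵇ-refl r₀) (≡ᵇ-refl c)) (≡ᵇ-refl c))
      (+-identityʳ stay)))
    ...     | no i≢r₀ = trans (change-row odd i i≤c i≢r₀)
      (sym (cong₂ (λ y x → (if y then stay else 0) + (if not x then move i c else 0))
                  (cong (_∧ (c ≡ᵇ c)) (≢⇒≡ᵇ-false i≢r₀)) (≡ᵇ-refl c)))

    -- Once the pair of s′ is closed, every admissible next entry opens a new pair.
    term-closed : isOdd (K c) ≡ false → ∀ i j → i < N → j < N → term i j ≡ (if nextEntryOk (suc c) i j then move i j else 0)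
    term-closed even i j _ j<N with nextEntryOk (suc c) i j in ok
    ... | false = refl
    ... | true with nextEntryOk⁻ (suc c) i j (≡true⇒T ok) | j ≟ c
    ...   | _ , c≤j , _ | no j≢c = move-to-new-column i j j<N (≡true⇒T ok) c≤j j≢c
    ...   | _ | yes refl = begin
        (if true ∧ not (properStep μ (s′ , r₀ , c) (suc s′ , i , c)) then next i c else 0)
      ≡⟨ allowed i c (properStep-closed μ s′ r₀ c i c (trans parity even)) ⟩
        next i c
      ≡⟨ IH′ i c c<N (≡true⇒T ok) ⟩
        expected (U ∪ i) c (tally K c) a m
      ≡⟨ expected-after-even (U ∪ i) K c a m c<N even ⟩
        move i c
      ∎
      where open ≡-Reasoning

    step : ΣΣ term ≡ expected U c K a (suc m)
    step with isOdd (K c) in parity-K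
    ... | true = begin
        ΣΣ term                                  ≡⟨ ΣΣ-cong (term-open parity-K) ⟩
        ΣΣ (λ i j → staying i j + moving i j)    ≡⟨ ΣΣ-+ staying moving ⟩
        ΣΣ staying + ΣΣ moving                   ≡⟨ cong (_+ ΣΣ moving) (ΣΣ-single r₀ c (≤-<-trans r₀≤c c<N) c<N off-diagonal) ⟩
        staying r₀ c + ΣΣ moving                 ≡⟨ cong (λ b → (if b then stay else 0) + ΣΣ moving) (cong₂ _∧_ (≡ᵇ-refl r₀) (≡ᵇ-refl c)) ⟩
        stay + ΣΣ moving                         ≡⟨ zShift-tailPoly-open U (suc c) m (semiW K) a ⟩
        zShift (semiW K) (tailPoly true U (suc c) (suc m)) a ∎
      where
      open ≡-Reasoning
      off-diagonal : ∀ i j → i < N → j < N → i ≢ r₀ ⊎ j ≢ c → staying i j ≡ 0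
      off-diagonal i j _ _ (inj₁ i≢r₀) rewrite ≢⇒≡ᵇ-false i≢r₀ = refl
      off-diagonal i j _ _ (inj₂ j≢c) rewrite ≢⇒≡ᵇ-false j≢c | ∧-zeroʳ (i ≡ᵇ r₀) = refl
    ... | false = trans (ΣΣ-cong (term-closed parity-K)) (zShift-tailPoly-closed U (suc c) m (semiW K) a)

  claim : (m : ℕ) → ClaimAt m
  claim zero    = claim-zero
  claim (suc m) U c s′ r₀ μ K a inv =
    trans (ippmCount-suc U (suc c) (s′ , r₀ , c) μ K a (suc s′) m) (ClaimStep.step m (claim m) U c s′ r₀ μ K a inv)

-- Assembling the dimensions

module Dimension (D : ℕ) where
  open IPPMCount (suc D)

  pmCoeff : ℕ → ℤ → ℕ
  pmCoeff a b = sum (map (λ v → if isPM (suc D , v) then mulPow (suc D) (tPow (+ (2 * a))) b else 0) (allVecs positions a))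

  ippmCoeff : ℕ → ℕ → ℕ
  ippmCoeff a b = countL (λ v → isIPPM (suc D , v) ∧ (semiWeight (suc D , v) ≡ᵇ a)) (allVecs positions b)

  -- Both sides, in dimension D + 1, reduce to this: the first entry of a
  -- partition matrix is forced to be 1 at position (0, 0).
  coeff : ℕ → ℤ → ℕ
  coeff zero    b = 0
  coeff (suc a) b = pmPoly (∅ ∪ 0) 1 a b

  first-entry : (V : ℕ → ℕ → ℕ) → ΣΣ (λ i j → if nextEntryOk 0 i j then V i j else 0) ≡ V 0 0
  first-entry V = ΣΣ-single 0 0 (s≤s z≤n) (s≤s z≤n) elsewhere
    where
    elsewhere : ∀ i j → i < suc D → j < suc D → i ≢ 0 ⊎ j ≢ 0 → (if nextEntryOk 0 i j then V i j else 0) ≡ 0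
    elsewhere zero    zero    _ _ (inj₁ 0≢0) = ⊥-elim (0≢0 refl)
    elsewhere zero    zero    _ _ (inj₂ 0≢0) = ⊥-elim (0≢0 refl)
    elsewhere (suc i) zero    _ _ _ = refl
    elsewhere i       (suc j) _ _ _ rewrite ∧-zeroʳ (0 ℕ.∸ 1 ≤ᵇ suc j) | ∧-zeroʳ (i ≤ᵇ suc j) = refl

  pmCoeff≡coeff : (a : ℕ) (b : ℤ) → pmCoeff a b ≡ coeff a b
  pmCoeff≡coeff a b = begin
      pmCoeff a b
    ≡⟨ sum-if≡countL* (λ v → isPM (suc D , v)) _ (allVecs positions a) ⟩
      countL (λ v → isPM (suc D , v)) (allVecs positions a) * W a
    ≡⟨ cong (_* W a) (trans (countL-cong (allVecs positions a) isPM≡pmTail) (countL-pmTail≡pmCount ∅ 0 1 a)) ⟩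
      pmCount ∅ 0 a * W a
    ≡⟨ after-first-entry a ⟩
      coeff a b
    ∎
    where
    open ≡-Reasoning
    W : ℕ → ℕ
    W a = mulPow (suc D) (tPow (+ (2 * a))) b
    after-first-entry : (a : ℕ) → pmCount ∅ 0 a * W a ≡ coeff a b
    after-first-entry zero     = refl
    after-first-entry (suc a′) = begin
        pmCount ∅ 0 (suc a′) * W (suc a′)
      ≡⟨ cong (_* W (suc a′)) (first-entry (λ i j → pmCount (∅ ∪ i) (suc j) a′)) ⟩
        pmCount (∅ ∪ 0) 1 a′ * binomT (suc D) (+ (2 * suc a′)) b
      ≡⟨ cong (λ x → pmCount (∅ ∪ 0) 1 a′ * binomT (suc D) x b) (sym (twice-suc≡ a′)) ⟩
        pmCount (∅ ∪ 0) 1 a′ * binomT (suc D) (twice-suc a′) b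
      ≡⟨ sym (pmPoly≡pmCount*binomT (∅ ∪ 0) 1 a′ b) ⟩
        coeff (suc a′) b
      ∎

  initial-invariant : Invariant (∅ ∪ 0) 0 1 0 1 (tally noCounts 0)
  initial-invariant = record
    { c<N = s≤s z≤n ; r₀≤c = z≤n ; r₀-used = refl ; later-empty = λ { (suc d) _ → refl }
    ; parity = refl ; s′≥1 = s≤s z≤n ; not-first = inj₂ refl }

  ippmCoeff≡coeff : (a b : ℕ) → ippmCoeff a b ≡ coeff a (+ b)
  ippmCoeff≡coeff zero    zero = refl
  ippmCoeff≡coeff (suc a) zero = sym (pmPoly-vanish (∅ ∪ 0) 1 a (+ 0) (ℤ.+≤+ z≤n))
  ippmCoeff≡coeff a (suc m) = begin
      ippmCoeff a (suc m)
    ≡⟨ countL-allVecs-∷ positions m _ _ (isIPPM-∷ a) ⟩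
      _
    ≡⟨ sum-positions (λ i j → if nextEntryOk 0 i j then ippmCount (∅ ∪ i) (suc j) (1 , i , j) 1 (tally noCounts j) a 2 m else 0) ⟩
      ΣΣ (λ i j → if nextEntryOk 0 i j then ippmCount (∅ ∪ i) (suc j) (1 , i , j) 1 (tally noCounts j) a 2 m else 0)
    ≡⟨ first-entry (λ i j → ippmCount (∅ ∪ i) (suc j) (1 , i , j) 1 (tally noCounts j) a 2 m) ⟩
      ippmCount (∅ ∪ 0) 1 (1 , 0 , 0) 1 (tally noCounts 0) a 2 m
    ≡⟨ claim m (∅ ∪ 0) 0 1 0 1 (tally noCounts 0) a initial-invariant ⟩
      zShift (semiW (tally noCounts 0)) (tailPoly true (∅ ∪ 0) 1 m) a
    ≡⟨ cong (λ S → zShift S (tailPoly true (∅ ∪ 0) 1 m) a) semiW-initial ⟩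
      zShift 1 (tailPoly true (∅ ∪ 0) 1 m) a
    ≡⟨ zShift-1 a ⟩
      coeff a (+ suc m)
    ∎
    where
    open ≡-Reasoning
    semiW-initial : semiW (tally noCounts 0) ≡ 1
    semiW-initial = trans (semiW-tally noCounts 0 (s≤s z≤n)) (cong (_+ 1) (sum-map-zero (upTo (suc D)) (λ _ → refl)))
    zShift-1 : (a : ℕ) → zShift 1 (tailPoly true (∅ ∪ 0) 1 m) a ≡ coeff a (+ suc m)
    zShift-1 zero    = refl
    zShift-1 (suc a) = refl

  coeff-vanish : (a b : ℕ) → a ≤ D ⊎ b ≤ D → coeff a (+ b) ≡ 0
  coeff-vanish zero     b _ = refl
  coeff-vanish (suc a′) b (inj₁ a≤D) = trans (pmPoly≡pmCount*binomT (∅ ∪ 0) 1 a′ (+ b))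
    (cong (_* binomT (suc D) (twice-suc a′) (+ b)) (pmCount-vanish (∅ ∪ 0) 1 a′ (s≤s (≤-trans (≤-reflexive (+-comm a′ 1)) a≤D))))
  coeff-vanish (suc a′) b (inj₂ b≤D) with suc a′ ≤? D
  ... | yes a≤D = coeff-vanish (suc a′) b (inj₁ a≤D)
  ... | no  a≰D = pmPoly-vanish (∅ ∪ 0) 1 a′ (+ b) (ℤ.+≤+ (≤-trans b≤D (≤-pred (≰⇒> a≰D))))

  coeff-negative : (a n : ℕ) → coeff a -[1+ n ] ≡ 0
  coeff-negative zero     n = refl
  coeff-negative (suc a′) n = pmPoly-vanish (∅ ∪ 0) 1 a′ -[1+ n ] ℤ.-≤+

lhsCoeff≡Σ : (a b : ℕ) → lhsCoeff a (+ b) ≡ Σ< b (λ D → Dimension.ippmCoeff D a b)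
lhsCoeff≡Σ a b = trans (sum-map-concatMap _ _ (upTo b)) (sum-map-cong (upTo b) (λ D → sum-map-∘ _ _ (allVecs _ b)))

rhsCoeff≡Σ : (a : ℕ) (b : ℤ) → rhsCoeff a b ≡ Σ< a (λ D → Dimension.pmCoeff D a b)
rhsCoeff≡Σ a b = trans (sum-map-concatMap _ _ (upTo a)) (sum-map-cong (upTo a) (λ D → sum-map-∘ _ _ (allVecs _ a)))

lemma3p2 : (a : ℕ) (b : ℤ) → lhsCoeff a b ≡ rhsCoeff a b
lemma3p2 a (+ b) = begin
    lhsCoeff a (+ b)                            ≡⟨ lhsCoeff≡Σ a b ⟩
    Σ< b (λ D → Dimension.ippmCoeff D a b)      ≡⟨ sum-map-cong (upTo b) (λ D → Dimension.ippmCoeff≡coeff D a b) ⟩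
    Σ< b (λ D → Dimension.coeff D a (+ b))      ≡⟨ only-small-dimensions ⟩
    Σ< a (λ D → Dimension.coeff D a (+ b))      ≡⟨ sum-map-cong (upTo a) (λ D → sym (Dimension.pmCoeff≡coeff D a (+ b))) ⟩
    Σ< a (λ D → Dimension.pmCoeff D a (+ b))    ≡⟨ rhsCoeff≡Σ a (+ b) ⟨
    rhsCoeff a (+ b)                            ∎
  where
  open ≡-Reasoning
  only-small-dimensions : Σ< b (λ D → Dimension.coeff D a (+ b)) ≡ Σ< a (λ D → Dimension.coeff D a (+ b))
  only-small-dimensions with ≤-total a b
  ... | inj₁ a≤b = Σ<-truncate a b a≤b (λ D a≤D _ → Dimension.coeff-vanish D a b (inj₁ a≤D))
  ... | inj₂ b≤a = sym (Σ<-truncate b a b≤a (λ D b≤D _ → Dimension.coeff-vanish D a b (inj₂ b≤D)))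
lemma3p2 a -[1+ n ] = sym (trans (rhsCoeff≡Σ a -[1+ n ])
  (trans (sum-map-cong (upTo a) (λ D → Dimension.pmCoeff≡coeff D a -[1+ n ]))
         (sum-map-zero (upTo a) (λ D → Dimension.coeff-negative D a n))))
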